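{- (1) Let $n_1,\dots,n_k$ be positive integers, $N=n_1+\cdots+n_k$, and $\mathcal{G}=K_{n_1}\vee K_{n_2}\vee\cdots\vee K_{n_k}$. Then the CN-Laplacian spectrum of $\mathcal{G}$ is $\{0^1,(N(N-2))^{N-1}\}$, the CN-signless Laplacian spectrum of $\mathcal{G}$ is $\{(2(N-1)(N-2))^1,((N-2)^2)^{N-1}\}$, and $LE_{CN}(\mathcal{G})=2(N-1)(N-2)=LE^+_{CN}(\mathcal{G})$. (2) Let $m,n$ be positive integers and $\mathcal{G}=\overline{K_m}\vee\overline{K_n}$. Then the CN-Laplacian spectrum of $\mathcal{G}$ is $\{0^2,(mn)^{m+n-2}\}$ and $LE_{CN}(\mathcal{G})=\frac{4mn(m+n-2)}{m+n}$; the CN-signless Laplacian spectrum of $\mathcal{G}$ is $\{(2n(m-1))^1,(n(m-2))^{m-1},(2m(n-1))^1,(m(n-2))^{n-1}\}$; and \[ LE^+_{CN}(\mathcal{G})=\begin{cases}\frac{2(n-1)(n+2)}{n+1} & \text{if } m=1,\ n\ge 2,\\[1mm] \frac{2(m-1)(m+2)}{m+1} & \text{if } m\ge 2,\ n=1,\\[1mm] \frac{4(m^2(n-1)+n^2(m-1))}{m+n} & \text{if } m,n\ge 2.\end{cases} \]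
   Context: Spectra are multisets, $x^a$ denoting eigenvalue $x$ with multiplicity $a$. $\mathcal{G}_1\vee\mathcal{G}_2$ is the join and $\overline{K_m}$ the complement of the complete graph $K_m$ (the edgeless graph on $m$ vertices). For a finite simple graph $\mathcal{G}$ on vertices $v_1,\dots,v_p$: $\mathrm{CN}(\mathcal{G})$ has $(i,j)$-entry $|N(v_i)\cap N(v_j)|$ for $i\neq j$ (open neighbourhoods) and $0$ on the diagonal; $\mathrm{CNRS}(\mathcal{G})$ is the diagonal matrix of row sums of $\mathrm{CN}(\mathcal{G})$; $\mathrm{CNL}=\mathrm{CNRS}-\mathrm{CN}$, $\mathrm{CNSL}=\mathrm{CNRS}+\mathrm{CN}$. The CN-Laplacian (resp. CN-signless Laplacian) spectrum is the spectrum of $\mathrm{CNL}(\mathcal{G})$ (resp. $\mathrm{CNSL}(\mathcal{G})$). $LE_{CN}(\mathcal{G})=\sum_\nu|\nu-tr(\mathrm{CNRS}(\mathcal{G}))/p|$ over eigenvalues of $\mathrm{CNL}(\mathcal{G})$ with multiplicity, and $LE^+_{CN}(\mathcal{G})$ likewise with $\mathrm{CNSL}(\mathcal{G})$. -}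

module Defs where

open import Data.Bool using (Bool; true; false; _∧_; not; if_then_else_)
open import Data.Nat as ℕ using (ℕ; zero; suc)
open import Data.Integer as ℤ using (ℤ; +_)
open import Data.Fin using (Fin; zero; suc; splitAt; punchIn; toℕ)
open import Data.Fin.Properties using (_≟_)
open import Data.Sum using (inj₁; inj₂)
open import Data.List using (List; []; _∷_)
open import Data.Nat.ListAction using (sum)
open import Data.Rational as ℚ using (ℚ; 0ℚ)
open import Relation.Nullary.Decidable using (⌊_⌋)
open import Relation.Binary.PropositionalEquality using (_≡_)

foldFin : {A : Set} → (A → A → A) → A → (n : ℕ) → (Fin n → A) → A
foldFin _⊕_ e zero    f = e
foldFin _⊕_ e (suc n) f = f zero ⊕ foldFin _⊕_ e n (λ i → f (suc i))

ΣℕFin : (n : ℕ) → (Fin n → ℕ) → ℕ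
ΣℕFin = foldFin ℕ._+_ 0

ΣℤFin : (n : ℕ) → (Fin n → ℤ) → ℤ
ΣℤFin = foldFin ℤ._+_ (+ 0)

Graph : ℕ → Set
Graph p = Fin p → Fin p → Bool

eq? : {p : ℕ} → Fin p → Fin p → Bool
eq? i j = ⌊ i ≟ j ⌋

K : (n : ℕ) → Graph n
K n i j = not (eq? i j)

complement : {p : ℕ} → Graph p → Graph p
complement G i j = not (eq? i j) ∧ not (G i j)

Kbar : (m : ℕ) → Graph m
Kbar m = complement (K m)

join : {a b : ℕ} → Graph a → Graph b → Graph (a ℕ.+ b)
join {a} G H i j with splitAt a i | splitAt a j
... | inj₁ x | inj₁ y = G x y
... | inj₂ x | inj₂ y = H x y
... | inj₁ _ | inj₂ _ = true
... | inj₂ _ | inj₁ _ = true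

-- K_{n1} ∨ K_{n2} ∨ ... ∨ K_{nk}  (the trailing join with the graph on
-- 0 vertices is harmless; vertex count is n1 + ... + nk)
joinK : (ns : List ℕ) → Graph (sum ns)
joinK []       = Kbar 0
joinK (n ∷ ns) = join (K n) (joinK ns)

Mat : ℕ → Set
Mat p = Fin p → Fin p → ℤ

commonNb : {p : ℕ} → Graph p → Fin p → Fin p → ℕ
commonNb {p} G i j = ΣℕFin p (λ v → if G i v ∧ G j v then 1 else 0)

CN : {p : ℕ} → Graph p → Mat p
CN G i j = if eq? i j then + 0 else + commonNb G i j

CNrowsum : {p : ℕ} → Graph p → Fin p → ℤ
CNrowsum {p} G i = ΣℤFin p (λ j → CN G i j)

CNRS : {p : ℕ} → Graph p → Mat p
CNRS G i j = if eq? i j then CNrowsum G i else + 0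

CNL : {p : ℕ} → Graph p → Mat p
CNL G i j = CNRS G i j ℤ.- CN G i j

CNSL : {p : ℕ} → Graph p → Mat p
CNSL G i j = CNRS G i j ℤ.+ CN G i j

trace : {p : ℕ} → Mat p → ℤ
trace {p} M = ΣℤFin p (λ i → M i i)

-- Polynomials over ℤ as coefficient lists (constant term first)

Poly : Set
Poly = List ℤ

_+P_ : Poly → Poly → Poly
[]       +P q        = q
p        +P []       = p
(a ∷ p)  +P (b ∷ q)  = (a ℤ.+ b) ∷ (p +P q)

scaleP : ℤ → Poly → Poly
scaleP c []      = []
scaleP c (a ∷ p) = (c ℤ.* a) ∷ scaleP c p

_*P_ : Poly → Poly → Poly
[]      *P q = []
(a ∷ p) *P q = scaleP a q +P (+ 0 ∷ (p *P q))

coeff : Poly → ℕ → ℤ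
coeff []      _       = + 0
coeff (a ∷ p) zero    = a
coeff (a ∷ p) (suc k) = coeff p k

-- equality of polynomials (coefficientwise; ignores trailing zeros)
_≈P_ : Poly → Poly → Set
p ≈P q = (k : ℕ) → coeff p k ≡ coeff q k

det : (n : ℕ) → (Fin n → Fin n → Poly) → Poly
det zero    M = + 1 ∷ []
det (suc n) M =
  foldFin _+P_ [] (suc n) (λ j →
    scaleP (sign (toℕ j)) (M zero j *P det n (λ r c → M (suc r) (punchIn j c))))
  where
  sign : ℕ → ℤ
  sign zero          = + 1
  sign (suc zero)    = ℤ.- (+ 1)
  sign (suc (suc k)) = sign k

charPoly : {p : ℕ} → Mat p → Poly
charPoly {p} M =
  det p (λ i j → if eq? i j then (ℤ.- M i j) ∷ + 1 ∷ [] else (ℤ.- M i j) ∷ [])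

prodLin : List ℤ → Poly
prodLin []      = + 1 ∷ []
prodLin (l ∷ L) = ((ℤ.- l) ∷ + 1 ∷ []) *P prodLin L

IsSpectrum : {p : ℕ} → Mat p → List ℤ → Set
IsSpectrum M L = charPoly M ≈P prodLin L

-- z / d as a rational (d is always positive where used; 0 if d = 0)
_/ₙ_ : ℤ → ℕ → ℚ
z /ₙ zero    = 0ℚ
z /ₙ suc d   = z ℚ./ suc d

energy : List ℤ → ℤ → ℕ → ℚ
energy []      t p = 0ℚ
energy (ν ∷ L) t p = ℚ.∣ (ν /ₙ 1) ℚ.- (t /ₙ p) ∣ ℚ.+ energy L t p

LECN-is : {p : ℕ} → Graph p → ℚ → Set
LECN-is {p} G v =
  (L : List ℤ) → IsSpectrum (CNL G) L → energy L (trace (CNRS G)) p ≡ v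

LECN⁺-is : {p : ℕ} → Graph p → ℚ → Set
LECN⁺-is {p} G v =
  (L : List ℤ) → IsSpectrum (CNSL G) L → energy L (trace (CNRS G)) p ≡ v

-- In K_{n1} ∨ … ∨ K_{nk} = K_N any two vertices have N - 2 common neighbours, so CN is
-- (N - 2)(J - I); in the complete bipartite graph \overline{K_m} ∨ \overline{K_n} two
-- vertices have n (resp. m) common neighbours on the same side and none across, so CN is
-- block diagonal with blocks of that shape. A (q+1) × (q+1) matrix with d on the diagonal
-- and o elsewhere has characteristic polynomial (x - d - q o)(x - d + o)^q: column
-- operations c_i := c_i - c_{i+1} turn x I - M into a matrix whose first-row expansion
-- recurses on the same shape and an upper triangular minor.
-- Products of linear factors over ℤ determine their roots up to permutation, which fixes
-- the spectra. The energies are measured from tr(CNRS)/N, which is the mean of the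
-- eigenvalues since CN has zero diagonal, so each eigenvalue contributes its deviation
-- from the mean.

module Submission where

open import Defs
open import Data.Nat as ℕ using (ℕ; _≤_; _∸_)
open import Data.Nat.ListAction using (sum)
open import Data.Integer as ℤ using (ℤ; +_)
open import Data.List using (List; []; _∷_; replicate; _++_)
open import Data.List.Relation.Unary.All using (All)
open import Data.Product using (_×_)
open import Relation.Binary.PropositionalEquality using (_≡_; _≢_)

open import Algebra.Bundles using (AbelianGroup)
open import Data.Bool using (Bool; true; false; not; _∧_; if_then_else_)
open import Data.Empty using (⊥; ⊥-elim)
open import Data.Nat using (zero; suc; z≤n; s≤s; z<s; s<s)
open import Data.Integer using (∣_∣)
open import Data.Fin using (Fin; zero; suc; toℕ; punchIn; fromℕ; fromℕ<; splitAt; _↑ˡ_; _↑ʳ_)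
import Data.Fin.Properties as FinP
import Data.Integer.Properties as ℤP
open import Data.Integer.Tactic.RingSolver using (solve-∀)
open import Data.List.Relation.Unary.All using (_∷_)
open import Data.List.Relation.Binary.Permutation.Propositional as ↭ using (_↭_; ↭-sym; ↭-reflexive)
open import Data.List.Relation.Binary.Permutation.Propositional.Properties using (shift)
import Data.Nat.Properties as ℕP
open import Data.Product using (Σ; Σ-syntax; _,_; proj₁; proj₂)
open import Data.Rational as ℚ using (ℚ; toℚᵘ)
import Data.Rational.Properties as ℚP
open import Data.Rational.Unnormalised as ℚᵘ using (mkℚᵘ; *≡*; _≃_)
import Data.Rational.Unnormalised.Properties as ℚᵘP
open import Data.Sum using (inj₁; inj₂)
open import Function using (_∘_)
open import Relation.Binary.Bundles using (Setoid)
open import Relation.Binary.Definitions using (tri<; tri≈; tri>)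
open import Relation.Binary.PropositionalEquality using (refl; sym; trans; cong; cong₂; subst; module ≡-Reasoning)
import Relation.Binary.Reasoning.Setoid as SetoidReasoning
open import Relation.Nullary using (yes; no)
open import Relation.Nullary.Decidable using (does; dec-true; dec-false)
open import Relation.Nullary.Negation using (contradiction)

open import Algebra.Properties.Group (AbelianGroup.group ℤP.+-0-abelianGroup)
  using () renaming (∙-cancelʳ to +-cancelʳ)
open import Algebra.Properties.CommutativeSemigroup ℕP.+-commutativeSemigroup
  using () renaming (interchange to ℕ-interchange)

-- A record wrapper of _≈P_: unlike a bare function type, it lets Agda infer both polynomials.
infix 4 _≈_
record _≈_ (p q : Poly) : Set where
  constructor ⟨_⟩
  field coeff-≡ : ∀ k → coeff p k ≡ coeff q k
open _≈_

≈-refl : ∀ {p} → p ≈ p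
≈-refl = ⟨ (λ _ → refl) ⟩

≈-sym : ∀ {p q} → p ≈ q → q ≈ p
≈-sym h = ⟨ (λ k → sym (coeff-≡ h k)) ⟩

≈-trans : ∀ {p q r} → p ≈ q → q ≈ r → p ≈ r
≈-trans h h' = ⟨ (λ k → trans (coeff-≡ h k) (coeff-≡ h' k)) ⟩

≡⇒≈ : ∀ {p q} → p ≡ q → p ≈ q
≡⇒≈ refl = ≈-refl

≈-setoid : Setoid _ _
≈-setoid = record
  { Carrier = Poly ; _≈_ = _≈_
  ; isEquivalence = record { refl = ≈-refl ; sym = ≈-sym ; trans = ≈-trans } }

module ≈-Reasoning = SetoidReasoning ≈-setoid

1P : Poly
1P = + 1 ∷ []

negP : Poly → Poly
negP = scaleP (ℤ.- + 1)

infixl 6 _-P_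
_-P_ : Poly → Poly → Poly
p -P q = p +P negP q

coeff-+P : ∀ p q k → coeff (p +P q) k ≡ coeff p k ℤ.+ coeff q k
coeff-+P []      q       k       = sym (ℤP.+-identityˡ _)
coeff-+P (a ∷ p) []      k       = sym (ℤP.+-identityʳ _)
coeff-+P (a ∷ p) (b ∷ q) zero    = refl
coeff-+P (a ∷ p) (b ∷ q) (suc k) = coeff-+P p q k

coeff-scaleP : ∀ c p k → coeff (scaleP c p) k ≡ c ℤ.* coeff p k
coeff-scaleP c []      k       = sym (ℤP.*-zeroʳ c)
coeff-scaleP c (a ∷ p) zero    = refl
coeff-scaleP c (a ∷ p) (suc k) = coeff-scaleP c p k

coeff-negP : ∀ p k → coeff (negP p) k ≡ ℤ.- coeff p k
coeff-negP p k = trans (coeff-scaleP _ p k) (ℤP.-1*i≡-i _)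

∷-cong : ∀ {a b p q} → a ≡ b → p ≈ q → a ∷ p ≈ b ∷ q
∷-cong a≡b p≈q = ⟨ (λ { zero → a≡b ; (suc k) → coeff-≡ p≈q k }) ⟩

∷-tail : ∀ {a b p q} → a ∷ p ≈ b ∷ q → p ≈ q
∷-tail h = ⟨ (λ k → coeff-≡ h (suc k)) ⟩

shift-≈[] : ∀ {p} → p ≈ [] → + 0 ∷ p ≈ []
shift-≈[] h = ⟨ (λ { zero → refl ; (suc k) → coeff-≡ h k }) ⟩

+P-cong : ∀ {p p' q q'} → p ≈ p' → q ≈ q' → p +P q ≈ p' +P q'
+P-cong {p} {p'} {q} {q'} h h' = ⟨ (λ k → begin
  coeff (p +P q) k           ≡⟨ coeff-+P p q k ⟩
  coeff p k ℤ.+ coeff q k    ≡⟨ cong₂ ℤ._+_ (coeff-≡ h k) (coeff-≡ h' k) ⟩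
  coeff p' k ℤ.+ coeff q' k  ≡⟨ coeff-+P p' q' k ⟨
  coeff (p' +P q') k         ∎) ⟩
  where open ≡-Reasoning

+P-comm : ∀ p q → p +P q ≈ q +P p
+P-comm p q = ⟨ (λ k → begin
  coeff (p +P q) k         ≡⟨ coeff-+P p q k ⟩
  coeff p k ℤ.+ coeff q k  ≡⟨ ℤP.+-comm (coeff p k) (coeff q k) ⟩
  coeff q k ℤ.+ coeff p k  ≡⟨ coeff-+P q p k ⟨
  coeff (q +P p) k         ∎) ⟩
  where open ≡-Reasoning

+P-assoc : ∀ p q r → (p +P q) +P r ≈ p +P (q +P r)
+P-assoc p q r = ⟨ (λ k → begin
  coeff ((p +P q) +P r) k                    ≡⟨ coeff-+P (p +P q) r k ⟩
  coeff (p +P q) k ℤ.+ coeff r k             ≡⟨ cong (ℤ._+ coeff r k) (coeff-+P p q k) ⟩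
  (coeff p k ℤ.+ coeff q k) ℤ.+ coeff r k    ≡⟨ ℤP.+-assoc (coeff p k) (coeff q k) (coeff r k) ⟩
  coeff p k ℤ.+ (coeff q k ℤ.+ coeff r k)    ≡⟨ cong (λ z → coeff p k ℤ.+ z) (coeff-+P q r k) ⟨
  coeff p k ℤ.+ coeff (q +P r) k             ≡⟨ coeff-+P p (q +P r) k ⟨
  coeff (p +P (q +P r)) k                    ∎) ⟩
  where open ≡-Reasoning

+P-identityʳ : ∀ p → p +P [] ≈ p
+P-identityʳ p = ⟨ (λ k → trans (coeff-+P p [] k) (ℤP.+-identityʳ _)) ⟩

+P-inverseʳ : ∀ p → p -P p ≈ []
+P-inverseʳ p = ⟨ (λ k → begin
  coeff (p -P p) k                ≡⟨ coeff-+P p (negP p) k ⟩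
  coeff p k ℤ.+ coeff (negP p) k  ≡⟨ cong (λ z → coeff p k ℤ.+ z) (coeff-negP p k) ⟩
  coeff p k ℤ.- coeff p k         ≡⟨ ℤP.+-inverseʳ (coeff p k) ⟩
  + 0                             ∎) ⟩
  where open ≡-Reasoning

+P-interchange : ∀ p q r s → (p +P q) +P (r +P s) ≈ (p +P r) +P (q +P s)
+P-interchange p q r s = begin
  (p +P q) +P (r +P s)  ≈⟨ +P-assoc p q (r +P s) ⟩
  p +P (q +P (r +P s))  ≈⟨ +P-cong (≈-refl {p}) (+P-assoc q r s) ⟨
  p +P ((q +P r) +P s)  ≈⟨ +P-cong (≈-refl {p}) (+P-cong (+P-comm q r) (≈-refl {s})) ⟩
  p +P ((r +P q) +P s)  ≈⟨ +P-cong (≈-refl {p}) (+P-assoc r q s) ⟩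
  p +P (r +P (q +P s))  ≈⟨ +P-assoc p r (q +P s) ⟨
  (p +P r) +P (q +P s)  ∎
  where open ≈-Reasoning

scaleP-cong : ∀ {c d p q} → c ≡ d → p ≈ q → scaleP c p ≈ scaleP d q
scaleP-cong {c} {d} {p} {q} refl h = ⟨ (λ k →
  trans (coeff-scaleP c p k) (trans (cong (c ℤ.*_) (coeff-≡ h k)) (sym (coeff-scaleP c q k)))) ⟩

scaleP-congʳ : ∀ c {p q} → p ≈ q → scaleP c p ≈ scaleP c q
scaleP-congʳ c = scaleP-cong {c} refl

scaleP-distribˡ : ∀ c p q → scaleP c (p +P q) ≈ scaleP c p +P scaleP c q
scaleP-distribˡ c p q = ⟨ (λ k → begin
  coeff (scaleP c (p +P q)) k                    ≡⟨ coeff-scaleP c (p +P q) k ⟩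
  c ℤ.* coeff (p +P q) k                         ≡⟨ cong (c ℤ.*_) (coeff-+P p q k) ⟩
  c ℤ.* (coeff p k ℤ.+ coeff q k)                ≡⟨ ℤP.*-distribˡ-+ c (coeff p k) (coeff q k) ⟩
  c ℤ.* coeff p k ℤ.+ c ℤ.* coeff q k            ≡⟨ cong₂ ℤ._+_ (coeff-scaleP c p k) (coeff-scaleP c q k) ⟨
  coeff (scaleP c p) k ℤ.+ coeff (scaleP c q) k  ≡⟨ coeff-+P (scaleP c p) (scaleP c q) k ⟨
  coeff (scaleP c p +P scaleP c q) k             ∎) ⟩
  where open ≡-Reasoning

scaleP-distribʳ : ∀ c d p → scaleP (c ℤ.+ d) p ≈ scaleP c p +P scaleP d p
scaleP-distribʳ c d p = ⟨ (λ k → begin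
  coeff (scaleP (c ℤ.+ d) p) k                   ≡⟨ coeff-scaleP (c ℤ.+ d) p k ⟩
  (c ℤ.+ d) ℤ.* coeff p k                        ≡⟨ ℤP.*-distribʳ-+ (coeff p k) c d ⟩
  c ℤ.* coeff p k ℤ.+ d ℤ.* coeff p k            ≡⟨ cong₂ ℤ._+_ (coeff-scaleP c p k) (coeff-scaleP d p k) ⟨
  coeff (scaleP c p) k ℤ.+ coeff (scaleP d p) k  ≡⟨ coeff-+P (scaleP c p) (scaleP d p) k ⟨
  coeff (scaleP c p +P scaleP d p) k             ∎) ⟩
  where open ≡-Reasoning

scaleP-assoc : ∀ c d p → scaleP c (scaleP d p) ≈ scaleP (c ℤ.* d) p
scaleP-assoc c d p = ⟨ (λ k → begin
  coeff (scaleP c (scaleP d p)) k  ≡⟨ coeff-scaleP c (scaleP d p) k ⟩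
  c ℤ.* coeff (scaleP d p) k       ≡⟨ cong (c ℤ.*_) (coeff-scaleP d p k) ⟩
  c ℤ.* (d ℤ.* coeff p k)          ≡⟨ ℤP.*-assoc c d (coeff p k) ⟨
  c ℤ.* d ℤ.* coeff p k            ≡⟨ coeff-scaleP (c ℤ.* d) p k ⟨
  coeff (scaleP (c ℤ.* d) p) k     ∎) ⟩
  where open ≡-Reasoning

scaleP-comm : ∀ c d p → scaleP c (scaleP d p) ≈ scaleP d (scaleP c p)
scaleP-comm c d p = ≈-trans (scaleP-assoc c d p)
  (≈-trans (scaleP-cong (ℤP.*-comm c d) ≈-refl) (≈-sym (scaleP-assoc d c p)))

scaleP-identity : ∀ p → scaleP (+ 1) p ≈ p
scaleP-identity p = ⟨ (λ k → trans (coeff-scaleP _ p k) (ℤP.*-identityˡ _)) ⟩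

scaleP-zeroˡ : ∀ p → scaleP (+ 0) p ≈ []
scaleP-zeroˡ p = ⟨ coeff-scaleP (+ 0) p ⟩

scaleP-zeroʳ : ∀ c {p} → p ≈ [] → scaleP c p ≈ []
scaleP-zeroʳ c {p} h = ⟨ (λ k →
  trans (coeff-scaleP c p k) (trans (cong (c ℤ.*_) (coeff-≡ h k)) (ℤP.*-zeroʳ c))) ⟩

scaleP-shift : ∀ c p → + 0 ∷ scaleP c p ≈ scaleP c (+ 0 ∷ p)
scaleP-shift c p = ∷-cong (sym (ℤP.*-zeroʳ c)) ≈-refl

scaleP-cancel : ∀ c {p q} → p ≈ q → scaleP c p +P scaleP (ℤ.- c) q ≈ []
scaleP-cancel c {p} {q} h = begin
  scaleP c p +P scaleP (ℤ.- c) q  ≈⟨ +P-cong (≈-refl {scaleP c p}) (scaleP-congʳ (ℤ.- c) h) ⟨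
  scaleP c p +P scaleP (ℤ.- c) p  ≈⟨ scaleP-distribʳ c (ℤ.- c) p ⟨
  scaleP (c ℤ.- c) p              ≈⟨ scaleP-cong (ℤP.+-inverseʳ c) ≈-refl ⟩
  scaleP (+ 0) p                  ≈⟨ scaleP-zeroˡ p ⟩
  []                              ∎
  where open ≈-Reasoning

*P-zeroʳ : ∀ p → p *P [] ≈ []
*P-zeroʳ []      = ≈-refl
*P-zeroʳ (a ∷ p) = shift-≈[] (*P-zeroʳ p)

*P-congʳ : ∀ p {q q'} → q ≈ q' → p *P q ≈ p *P q'
*P-congʳ []      h = ≈-refl
*P-congʳ (a ∷ p) h = +P-cong (scaleP-congʳ a h) (∷-cong refl (*P-congʳ p h))

*P-zeroˡ : ∀ {p} q → p ≈ [] → p *P q ≈ []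
*P-zeroˡ {[]}    q h = ≈-refl
*P-zeroˡ {b ∷ p} q h =
  ≈-trans (+P-cong (≈-trans (scaleP-cong {p = q} (coeff-≡ h 0) ≈-refl) (scaleP-zeroˡ q)) ≈-refl)
          (shift-≈[] (*P-zeroˡ {p} q ⟨ (λ k → coeff-≡ h (suc k)) ⟩))

*P-congˡ : ∀ {p p'} q → p ≈ p' → p *P q ≈ p' *P q
*P-congˡ {[]}    {[]}     q h = ≈-refl
*P-congˡ {[]}    {b ∷ p'} q h = ≈-sym (*P-zeroˡ q (≈-sym h))
*P-congˡ {a ∷ p} {[]}     q h = *P-zeroˡ q h
*P-congˡ {a ∷ p} {b ∷ p'} q h =
  +P-cong (scaleP-cong {p = q} (coeff-≡ h 0) ≈-refl) (∷-cong refl (*P-congˡ q (∷-tail h)))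

*P-cong : ∀ {p p' q q'} → p ≈ p' → q ≈ q' → p *P q ≈ p' *P q'
*P-cong {p' = p'} {q = q} h h' = ≈-trans (*P-congˡ q h) (*P-congʳ p' h')

*P-distribʳ : ∀ p p' q → (p +P p') *P q ≈ (p *P q) +P (p' *P q)
*P-distribʳ []      p'       q = ≈-refl
*P-distribʳ (a ∷ p) []       q = ≈-sym (+P-identityʳ _)
*P-distribʳ (a ∷ p) (b ∷ p') q =
  ≈-trans (+P-cong (scaleP-distribʳ a b q) (∷-cong refl (*P-distribʳ p p' q)))
          (+P-interchange (scaleP a q) (scaleP b q) (+ 0 ∷ (p *P q)) (+ 0 ∷ (p' *P q)))

*P-distribˡ : ∀ p q q' → p *P (q +P q') ≈ (p *P q) +P (p *P q')
*P-distribˡ []      q q' = ≈-refl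
*P-distribˡ (a ∷ p) q q' =
  ≈-trans (+P-cong (scaleP-distribˡ a q q') (∷-cong refl (*P-distribˡ p q q')))
          (+P-interchange (scaleP a q) (scaleP a q') (+ 0 ∷ (p *P q)) (+ 0 ∷ (p *P q')))

scaleP-*Pˡ : ∀ c p q → scaleP c p *P q ≈ scaleP c (p *P q)
scaleP-*Pˡ c []      q = ≈-refl
scaleP-*Pˡ c (a ∷ p) q =
  ≈-trans (+P-cong (≈-sym (scaleP-assoc c a q))
                   (≈-trans (∷-cong refl (scaleP-*Pˡ c p q)) (scaleP-shift c (p *P q))))
          (≈-sym (scaleP-distribˡ c (scaleP a q) (+ 0 ∷ (p *P q))))

scaleP-*Pʳ : ∀ c p q → p *P scaleP c q ≈ scaleP c (p *P q)
scaleP-*Pʳ c []      q = ≈-refl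
scaleP-*Pʳ c (a ∷ p) q =
  ≈-trans (+P-cong (scaleP-comm a c q)
                   (≈-trans (∷-cong refl (scaleP-*Pʳ c p q)) (scaleP-shift c (p *P q))))
          (≈-sym (scaleP-distribˡ c (scaleP a q) (+ 0 ∷ (p *P q))))

*P-shiftʳ : ∀ p q → p *P (+ 0 ∷ q) ≈ + 0 ∷ (p *P q)
*P-shiftʳ []      q = ≈-sym (shift-≈[] ≈-refl)
*P-shiftʳ (a ∷ p) q =
  ∷-cong (trans (ℤP.+-identityʳ _) (ℤP.*-zeroʳ a)) (+P-cong (≈-refl {scaleP a q}) (*P-shiftʳ p q))

*P-constantʳ : ∀ q a → q *P (a ∷ []) ≈ scaleP a q
*P-constantʳ []      a = ≈-refl
*P-constantʳ (b ∷ q) a = ∷-cong (trans (ℤP.+-identityʳ _) (ℤP.*-comm b a)) (*P-constantʳ q a)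

*P-∷ʳ : ∀ q a p → q *P (a ∷ p) ≈ scaleP a q +P (+ 0 ∷ (q *P p))
*P-∷ʳ q a p = begin
  q *P (a ∷ p)                           ≈⟨ *P-congʳ q (∷-cong (sym (ℤP.+-identityʳ a)) ≈-refl) ⟩
  q *P ((a ∷ []) +P (+ 0 ∷ p))           ≈⟨ *P-distribˡ q (a ∷ []) (+ 0 ∷ p) ⟩
  (q *P (a ∷ [])) +P (q *P (+ 0 ∷ p))      ≈⟨ +P-cong (*P-constantʳ q a) (*P-shiftʳ q p) ⟩
  scaleP a q +P (+ 0 ∷ (q *P p))         ∎
  where open ≈-Reasoning

*P-comm : ∀ p q → p *P q ≈ q *P p
*P-comm []      q = ≈-sym (*P-zeroʳ q)
*P-comm (a ∷ p) q =
  ≈-trans (+P-cong (≈-refl {scaleP a q}) (∷-cong refl (*P-comm p q))) (≈-sym (*P-∷ʳ q a p))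

*P-assoc : ∀ p q r → (p *P q) *P r ≈ p *P (q *P r)
*P-assoc []      q r = ≈-refl
*P-assoc (a ∷ p) q r =
  ≈-trans (*P-distribʳ (scaleP a q) (+ 0 ∷ (p *P q)) r)
          (+P-cong (scaleP-*Pˡ a q r)
                   (≈-trans (+P-cong (scaleP-zeroˡ r) ≈-refl) (∷-cong refl (*P-assoc p q r))))

*P-identityˡ : ∀ q → 1P *P q ≈ q
*P-identityˡ q = ≈-trans (+P-cong (scaleP-identity q) (shift-≈[] ≈-refl)) (+P-identityʳ q)

*P-identityʳ : ∀ q → q *P 1P ≈ q
*P-identityʳ q = ≈-trans (*P-comm q 1P) (*P-identityˡ q)

scaleP-*P-linearˡ : ∀ s l a b d → scaleP s ((a +P scaleP l b) *P d) ≈ scaleP s (a *P d) +P scaleP l (scaleP s (b *P d))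
scaleP-*P-linearˡ s l a b d = begin
  scaleP s ((a +P scaleP l b) *P d)                      ≈⟨ scaleP-congʳ s (*P-distribʳ a (scaleP l b) d) ⟩
  scaleP s ((a *P d) +P (scaleP l b *P d))               ≈⟨ scaleP-distribˡ s (a *P d) (scaleP l b *P d) ⟩
  scaleP s (a *P d) +P scaleP s (scaleP l b *P d)        ≈⟨ +P-cong (≈-refl {scaleP s (a *P d)}) (scaleP-congʳ s (scaleP-*Pˡ l b d)) ⟩
  scaleP s (a *P d) +P scaleP s (scaleP l (b *P d))      ≈⟨ +P-cong (≈-refl {scaleP s (a *P d)}) (scaleP-comm s l (b *P d)) ⟩
  scaleP s (a *P d) +P scaleP l (scaleP s (b *P d))      ∎
  where open ≈-Reasoning

scaleP-*P-linearʳ : ∀ s l a d d' → scaleP s (a *P (d +P scaleP l d')) ≈ scaleP s (a *P d) +P scaleP l (scaleP s (a *P d'))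
scaleP-*P-linearʳ s l a d d' = begin
  scaleP s (a *P (d +P scaleP l d'))                     ≈⟨ scaleP-congʳ s (*P-distribˡ a d (scaleP l d')) ⟩
  scaleP s ((a *P d) +P (a *P scaleP l d'))              ≈⟨ scaleP-distribˡ s (a *P d) (a *P scaleP l d') ⟩
  scaleP s (a *P d) +P scaleP s (a *P scaleP l d')       ≈⟨ +P-cong (≈-refl {scaleP s (a *P d)}) (scaleP-congʳ s (scaleP-*Pʳ l a d')) ⟩
  scaleP s (a *P d) +P scaleP s (scaleP l (a *P d'))     ≈⟨ +P-cong (≈-refl {scaleP s (a *P d)}) (scaleP-comm s l (a *P d')) ⟩
  scaleP s (a *P d) +P scaleP l (scaleP s (a *P d'))     ∎
  where open ≈-Reasoning

infixr 8 _^P_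
_^P_ : Poly → ℕ → Poly
e ^P zero  = 1P
e ^P suc k = e *P (e ^P k)

^P-cong : ∀ {e e'} k → e ≈ e' → e ^P k ≈ e' ^P k
^P-cong zero    h = ≈-refl
^P-cong (suc k) h = *P-cong h (^P-cong k h)

eq?-refl : ∀ {n} (i : Fin n) → eq? i i ≡ true
eq?-refl i with i FinP.≟ i
... | yes _  = refl
... | no i≢i = contradiction refl i≢i

eq?-≢ : ∀ {n} {i j : Fin n} → i ≢ j → eq? i j ≡ false
eq?-≢ {i = i} {j} i≢j with i FinP.≟ j
... | yes i≡j = contradiction i≡j i≢j
... | no _    = refl

eq?-suc : ∀ {n} (i j : Fin n) → eq? (suc i) (suc j) ≡ eq? i j
eq?-suc i j with i FinP.≟ j
... | yes refl = refl
... | no _     = refl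

eq?-↑ˡ : ∀ {a} b (x y : Fin a) → eq? (x ↑ˡ b) (y ↑ˡ b) ≡ eq? x y
eq?-↑ˡ b x y with x FinP.≟ y
... | yes refl = eq?-refl (x ↑ˡ b)
... | no x≢y   = eq?-≢ (x≢y ∘ FinP.↑ˡ-injective b x y)

eq?-↑ʳ : ∀ a {b} (x y : Fin b) → eq? (a ↑ʳ x) (a ↑ʳ y) ≡ eq? x y
eq?-↑ʳ a x y with x FinP.≟ y
... | yes refl = eq?-refl (a ↑ʳ x)
... | no x≢y   = eq?-≢ (x≢y ∘ FinP.↑ʳ-injective a x y)

↑ˡ≢↑ʳ : ∀ {a b} (x : Fin a) (y : Fin b) → x ↑ˡ b ≢ a ↑ʳ y
↑ˡ≢↑ʳ {a} {b} x y e = ℕP.<⇒≱ (FinP.toℕ<n x) (begin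
  a                ≤⟨ ℕP.m≤m+n a (toℕ y) ⟩
  a ℕ.+ toℕ y      ≡⟨ FinP.toℕ-↑ʳ a y ⟨
  toℕ (a ↑ʳ y)     ≡⟨ cong toℕ e ⟨
  toℕ (x ↑ˡ b)     ≡⟨ FinP.toℕ-↑ˡ x b ⟩
  toℕ x            ∎)
  where open ℕP.≤-Reasoning

eq?-↑ˡ-↑ʳ : ∀ {a b} (x : Fin a) (y : Fin b) → eq? (x ↑ˡ b) (a ↑ʳ y) ≡ false
eq?-↑ˡ-↑ʳ x y = eq?-≢ (↑ˡ≢↑ʳ x y)

eq?-↑ʳ-↑ˡ : ∀ {a b} (x : Fin a) (y : Fin b) → eq? (a ↑ʳ y) (x ↑ˡ b) ≡ false
eq?-↑ʳ-↑ˡ x y = eq?-≢ (↑ˡ≢↑ʳ x y ∘ sym)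

PM : ℕ → Set
PM n = Fin n → Fin n → Poly

minor : ∀ {n} → PM (suc n) → Fin (suc n) → PM n
minor M j r c = M (suc r) (punchIn j c)

ΣP : ∀ n → (Fin n → Poly) → Poly
ΣP = foldFin _+P_ []

ΣP-cong : ∀ n {f g : Fin n → Poly} → (∀ j → f j ≈ g j) → ΣP n f ≈ ΣP n g
ΣP-cong zero    h = ≈-refl
ΣP-cong (suc n) h = +P-cong (h zero) (ΣP-cong n (λ j → h (suc j)))

ΣP-zero : ∀ n {f : Fin n → Poly} → (∀ j → f j ≈ []) → ΣP n f ≈ []
ΣP-zero zero    h = ≈-refl
ΣP-zero (suc n) h = +P-cong (h zero) (ΣP-zero n (λ j → h (suc j)))

ΣP-single : ∀ n (f : Fin n → Poly) j → (∀ i → i ≢ j → f i ≈ []) → ΣP n f ≈ f j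
ΣP-single (suc n) f zero    h =
  ≈-trans (+P-cong (≈-refl {f zero}) (ΣP-zero n (λ i → h (suc i) (λ ())))) (+P-identityʳ (f zero))
ΣP-single (suc n) f (suc j) h =
  +P-cong (h zero (λ ())) (ΣP-single n (λ i → f (suc i)) j (λ i i≢j → h (suc i) (λ e → i≢j (FinP.suc-injective e))))

ΣP-+P : ∀ n (f g : Fin n → Poly) → ΣP n (λ j → f j +P g j) ≈ ΣP n f +P ΣP n g
ΣP-+P zero    f g = ≈-refl
ΣP-+P (suc n) f g =
  ≈-trans (+P-cong (≈-refl {f zero +P g zero}) (ΣP-+P n (λ j → f (suc j)) (λ j → g (suc j))))
          (+P-interchange (f zero) (g zero) (ΣP n (λ j → f (suc j))) (ΣP n (λ j → g (suc j))))

ΣP-scaleP : ∀ n c (f : Fin n → Poly) → ΣP n (λ j → scaleP c (f j)) ≈ scaleP c (ΣP n f)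
ΣP-scaleP zero    c f = ≈-refl
ΣP-scaleP (suc n) c f =
  ≈-trans (+P-cong (≈-refl {scaleP c (f zero)}) (ΣP-scaleP n c (λ j → f (suc j))))
          (≈-sym (scaleP-distribˡ c (f zero) _))

ΣP-*P : ∀ n (f : Fin n → Poly) q → ΣP n (λ j → f j *P q) ≈ ΣP n f *P q
ΣP-*P zero    f q = ≈-refl
ΣP-*P (suc n) f q =
  ≈-trans (+P-cong (≈-refl {f zero *P q}) (ΣP-*P n (λ j → f (suc j)) q)) (≈-sym (*P-distribʳ (f zero) _ q))

altSign : ℕ → ℤ
altSign zero          = + 1
altSign (suc zero)    = ℤ.- + 1
altSign (suc (suc k)) = altSign k

altSign-suc : ∀ k → altSign (suc k) ≡ ℤ.- altSign k
altSign-suc zero          = refl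
altSign-suc (suc zero)    = refl
altSign-suc (suc (suc k)) = altSign-suc k

laplaceTerm : ∀ n → PM (suc n) → Fin (suc n) → Poly
laplaceTerm n M j = scaleP (altSign (toℕ j)) (M zero j *P det n (minor M j))

-- `det` takes its signs from a function local to Defs, which cannot be named here: the `_`
-- below is solved by unification. That function ignores the matrix and its size, and Agda
-- identifies its values across both, which is what makes detSign≡altSign a two-step induction.
det-unfold : ∀ n (M : PM (suc n)) → Σ (Fin n → ℤ) λ s →
  det (suc n) M ≡ laplaceTerm n M zero +P ΣP n (λ i → scaleP (s i) (M zero (suc i) *P det n (minor M (suc i))))
det-unfold n M = (λ _ → _) , refl

detSign : ∀ n → PM (suc n) → Fin n → ℤ
detSign n M = proj₁ (det-unfold n M)

detSign≡altSign : ∀ n (M : PM (suc n)) i → detSign n M i ≡ altSign (suc (toℕ i))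
detSign≡altSign (suc n)       M zero          = refl
detSign≡altSign (suc (suc n)) M (suc zero)    = refl
detSign≡altSign (suc (suc n)) M (suc (suc i)) = detSign≡altSign n (λ _ _ → []) i

det-laplace : ∀ n (M : PM (suc n)) → det (suc n) M ≈ ΣP (suc n) (laplaceTerm n M)
det-laplace n M = ≈-trans (≡⇒≈ (proj₂ (det-unfold n M)))
  (+P-cong (≈-refl {laplaceTerm n M zero}) (ΣP-cong n (λ i → scaleP-cong (detSign≡altSign n M i) ≈-refl)))

det-cong : ∀ n {M N : PM n} → (∀ r c → M r c ≈ N r c) → det n M ≈ det n N
det-cong zero    h = ≈-refl
det-cong (suc n) {M} {N} h = begin
  det (suc n) M                  ≈⟨ det-laplace n M ⟩
  ΣP (suc n) (laplaceTerm n M)   ≈⟨ ΣP-cong (suc n) (λ j → scaleP-congʳ (altSign (toℕ j))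
                                      (*P-cong (h zero j) (det-cong n (λ r c → h (suc r) (punchIn j c))))) ⟩
  ΣP (suc n) (laplaceTerm n N)   ≈⟨ det-laplace n N ⟨
  det (suc n) N                  ∎
  where open ≈-Reasoning

-- Columns are located by their position `toℕ c`; `punchOutℕ j k` is the position that
-- column k of a matrix takes in its minor along column j ≠ k.
punchOutℕ : ℕ → ℕ → ℕ
punchOutℕ zero    k       = ℕ.pred k
punchOutℕ (suc j) zero    = zero
punchOutℕ (suc j) (suc k) = suc (punchOutℕ j k)

toℕ-punchIn⇒punchOutℕ : ∀ {n} (j : Fin (suc n)) k (c : Fin n) → toℕ j ≢ k →
                        toℕ (punchIn j c) ≡ k → toℕ c ≡ punchOutℕ (toℕ j) k
toℕ-punchIn⇒punchOutℕ zero    k       c       j≢k refl = refl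
toℕ-punchIn⇒punchOutℕ (suc j) k       zero    j≢k refl = refl
toℕ-punchIn⇒punchOutℕ {suc n} (suc j) (suc k) (suc c) j≢k e =
  cong suc (toℕ-punchIn⇒punchOutℕ j k c (j≢k ∘ cong suc) (ℕP.suc-injective e))

punchOutℕ⇒toℕ-punchIn : ∀ {n} (j : Fin (suc n)) k (c : Fin n) → toℕ j ≢ k →
                        toℕ c ≡ punchOutℕ (toℕ j) k → toℕ (punchIn j c) ≡ k
punchOutℕ⇒toℕ-punchIn zero    zero    c       j≢k e  = contradiction refl j≢k
punchOutℕ⇒toℕ-punchIn zero    (suc k) c       j≢k e  = cong suc e
punchOutℕ⇒toℕ-punchIn (suc j) zero    zero    j≢k e  = refl
punchOutℕ⇒toℕ-punchIn (suc j) (suc k) zero    j≢k ()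
punchOutℕ⇒toℕ-punchIn {suc n} (suc j) zero    (suc c) j≢k ()
punchOutℕ⇒toℕ-punchIn {suc n} (suc j) (suc k) (suc c) j≢k e =
  cong suc (punchOutℕ⇒toℕ-punchIn j k c (j≢k ∘ cong suc) (ℕP.suc-injective e))

punchOutℕ-< : ∀ {n} (j : Fin (suc n)) k → toℕ j ≢ k → k ℕ.< suc n → punchOutℕ (toℕ j) k ℕ.< n
punchOutℕ-< zero    zero    j≢k k<       = contradiction refl j≢k
punchOutℕ-< zero    (suc k) j≢k (s<s k<) = k<
punchOutℕ-< {suc n} (suc j) zero    j≢k k<       = z<s
punchOutℕ-< {suc n} (suc j) (suc k) j≢k (s<s k<) = s<s (punchOutℕ-< j k (j≢k ∘ cong suc) k<)

punchOutℕ-suc : ∀ j k → j ≢ k → j ≢ suc k → punchOutℕ j (suc k) ≡ suc (punchOutℕ j k)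
punchOutℕ-suc zero          zero    j≢k j≢k+1 = contradiction refl j≢k
punchOutℕ-suc zero          (suc k) j≢k j≢k+1 = refl
punchOutℕ-suc (suc zero)    zero    j≢k j≢k+1 = contradiction refl j≢k+1
punchOutℕ-suc (suc (suc j)) zero    j≢k j≢k+1 = refl
punchOutℕ-suc (suc j)       (suc k) j≢k j≢k+1 = cong suc (punchOutℕ-suc j k (j≢k ∘ cong suc) (j≢k+1 ∘ cong suc))

toℕ-punchIn-≥ : ∀ {n} (j : Fin (suc n)) (c : Fin n) → toℕ j ℕ.≤ toℕ c → toℕ (punchIn j c) ≡ suc (toℕ c)
toℕ-punchIn-≥ zero    c       j≤c       = refl
toℕ-punchIn-≥ {suc n} (suc j) (suc c) (s≤s j≤c) = cong suc (toℕ-punchIn-≥ j c j≤c)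

toℕ-punchIn-< : ∀ {n} (j : Fin (suc n)) (c : Fin n) → toℕ c ℕ.< toℕ j → toℕ (punchIn j c) ≡ toℕ c
toℕ-punchIn-< {suc n} (suc j) zero    c<j       = refl
toℕ-punchIn-< {suc n} (suc j) (suc c) (s<s c<j) = cong suc (toℕ-punchIn-< j c c<j)

toℕ-punchIn≢ : ∀ {n} (j : Fin (suc n)) c → toℕ (punchIn j c) ≢ toℕ j
toℕ-punchIn≢ j c e = FinP.punchInᵢ≢i j c (FinP.toℕ-injective e)

det-linear : ∀ n k → k ℕ.< n → (N U V : PM n) (l : ℤ) →
  (∀ r c → toℕ c ≢ k → N r c ≈ U r c) → (∀ r c → toℕ c ≢ k → N r c ≈ V r c) →
  (∀ r c → toℕ c ≡ k → N r c ≈ U r c +P scaleP l (V r c)) →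
  det n N ≈ det n U +P scaleP l (det n V)
det-linear (suc n) k k<n N U V l N≈U N≈V N≈U+lV = begin
  det (suc n) N                                                   ≈⟨ det-laplace n N ⟩
  ΣP (suc n) (laplaceTerm n N)                                    ≈⟨ ΣP-cong (suc n) term-linear ⟩
  ΣP (suc n) (λ j → laplaceTerm n U j +P scaleP l (laplaceTerm n V j))
                                                                  ≈⟨ ΣP-+P (suc n) (laplaceTerm n U) (λ j → scaleP l (laplaceTerm n V j)) ⟩
  ΣP (suc n) (laplaceTerm n U) +P ΣP (suc n) (λ j → scaleP l (laplaceTerm n V j))
                                                                  ≈⟨ +P-cong (≈-refl {ΣP (suc n) (laplaceTerm n U)}) (ΣP-scaleP (suc n) l (laplaceTerm n V)) ⟩
  ΣP (suc n) (laplaceTerm n U) +P scaleP l (ΣP (suc n) (laplaceTerm n V))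
                                                                  ≈⟨ +P-cong (det-laplace n U) (scaleP-congʳ l (det-laplace n V)) ⟨
  det (suc n) U +P scaleP l (det (suc n) V)                       ∎
  where
  open ≈-Reasoning
  term-linear : ∀ j → laplaceTerm n N j ≈ laplaceTerm n U j +P scaleP l (laplaceTerm n V j)
  term-linear j with toℕ j ℕ.≟ k
  ... | yes j≡k = ≈-trans (scaleP-congʳ s (*P-congˡ d (N≈U+lV zero j j≡k)))
    (≈-trans (scaleP-*P-linearˡ s l (U zero j) (V zero j) d)
             (+P-cong (scaleP-congʳ s (*P-congʳ (U zero j) (same-minor N≈U)))
                      (scaleP-congʳ l (scaleP-congʳ s (*P-congʳ (V zero j) (same-minor N≈V))))))
    where
    s = altSign (toℕ j)
    d = det n (minor N j)
    same-minor : ∀ {W} → (∀ r c → toℕ c ≢ k → N r c ≈ W r c) → det n (minor N j) ≈ det n (minor W j)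
    same-minor N≈W = det-cong n (λ r c → N≈W (suc r) (punchIn j c) (λ e → toℕ-punchIn≢ j c (trans e (sym j≡k))))
  ... | no j≢k = ≈-trans (scaleP-congʳ s (*P-congʳ (N zero j) minor-linear))
    (≈-trans (scaleP-*P-linearʳ s l (N zero j) (det n (minor U j)) (det n (minor V j)))
             (+P-cong (scaleP-congʳ s (*P-congˡ (det n (minor U j)) (N≈U zero j j≢k)))
                      (scaleP-congʳ l (scaleP-congʳ s (*P-congˡ (det n (minor V j)) (N≈V zero j j≢k))))))
    where
    s = altSign (toℕ j)
    minor-linear : det n (minor N j) ≈ det n (minor U j) +P scaleP l (det n (minor V j))
    minor-linear = det-linear n (punchOutℕ (toℕ j) k) (punchOutℕ-< j k j≢k k<n) (minor N j) (minor U j) (minor V j) l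
      (λ r c c≢k' → N≈U (suc r) (punchIn j c) (c≢k' ∘ toℕ-punchIn⇒punchOutℕ j k c j≢k))
      (λ r c c≢k' → N≈V (suc r) (punchIn j c) (c≢k' ∘ toℕ-punchIn⇒punchOutℕ j k c j≢k))
      (λ r c c≡k' → N≈U+lV (suc r) (punchIn j c) (punchOutℕ⇒toℕ-punchIn j k c j≢k c≡k'))

ΣP-adjacentPair : ∀ n (f : Fin n → Poly) k → suc k ℕ.< n →
  (∀ j → toℕ j ≢ k → toℕ j ≢ suc k → f j ≈ []) →
  (∀ j j' → toℕ j ≡ k → toℕ j' ≡ suc k → f j +P f j' ≈ []) → ΣP n f ≈ []
ΣP-adjacentPair (suc (suc n)) f zero    k+1<n others pair = begin
  f zero +P (f (suc zero) +P rest)  ≈⟨ +P-assoc (f zero) (f (suc zero)) rest ⟨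
  (f zero +P f (suc zero)) +P rest  ≈⟨ +P-cong (pair zero (suc zero) refl refl) (ΣP-zero n (λ j → others (suc (suc j)) (λ ()) (λ ()))) ⟩
  []                                ∎
  where
  open ≈-Reasoning
  rest = ΣP n (λ j → f (suc (suc j)))
ΣP-adjacentPair (suc n) f (suc k) (s<s k+1<n) others pair =
  +P-cong (others zero (λ ()) (λ ()))
          (ΣP-adjacentPair n (λ j → f (suc j)) k k+1<n
             (λ j j≢k j≢k+1 → others (suc j) (j≢k ∘ ℕP.suc-injective) (j≢k+1 ∘ ℕP.suc-injective))
             (λ j j' j≡k j'≡k+1 → pair (suc j) (suc j') (cong suc j≡k) (cong suc j'≡k+1)))

-- Expanding along the first row, the two terms of the equal adjacent columns cancel
-- (their minors agree and their signs are opposite); all other minors keep two equal adjacent columns.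
det-adjacentEqualColumns : ∀ n k → suc k ℕ.< n → (M : PM n) →
  (∀ r c c' → toℕ c ≡ k → toℕ c' ≡ suc k → M r c ≈ M r c') → det n M ≈ []
det-adjacentEqualColumns (suc n) k k+1<n M equal =
  ≈-trans (det-laplace n M) (ΣP-adjacentPair (suc n) (laplaceTerm n M) k k+1<n other-term pair-cancels)
  where
  other-term : ∀ j → toℕ j ≢ k → toℕ j ≢ suc k → laplaceTerm n M j ≈ []
  other-term j j≢k j≢k+1 =
    let shift = punchOutℕ-suc (toℕ j) k j≢k j≢k+1
        k'+1<n = subst (ℕ._< n) shift (punchOutℕ-< j (suc k) j≢k+1 k+1<n)
        minor≈[] = det-adjacentEqualColumns n (punchOutℕ (toℕ j) k) k'+1<n (minor M j)
          (λ r c c' c≡k' c'≡k'+1 → equal (suc r) (punchIn j c) (punchIn j c')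
             (punchOutℕ⇒toℕ-punchIn j k c j≢k c≡k')
             (punchOutℕ⇒toℕ-punchIn j (suc k) c' j≢k+1 (trans c'≡k'+1 (sym shift))))
    in scaleP-zeroʳ (altSign (toℕ j)) (≈-trans (*P-congʳ (M zero j) minor≈[]) (*P-zeroʳ (M zero j)))
  pair-cancels : ∀ j j' → toℕ j ≡ k → toℕ j' ≡ suc k → laplaceTerm n M j +P laplaceTerm n M j' ≈ []
  pair-cancels j j' j≡k j'≡k+1 =
    ≈-trans (+P-cong (≈-refl {laplaceTerm n M j}) (scaleP-cong opposite-sign ≈-refl))
            (scaleP-cancel (altSign (toℕ j)) (*P-cong (equal zero j j' j≡k j'≡k+1) (det-cong n same-minor)))
    where
    opposite-sign : altSign (toℕ j') ≡ ℤ.- altSign (toℕ j)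
    opposite-sign = trans (cong altSign (trans j'≡k+1 (cong suc (sym j≡k)))) (altSign-suc (toℕ j))
    same-minor : ∀ r c → minor M j r c ≈ minor M j' r c
    same-minor r c with ℕP.<-cmp (toℕ c) k
    ... | tri< c<k _ _ = ≡⇒≈ (cong (M (suc r)) (FinP.toℕ-injective
           (trans (toℕ-punchIn-< j c (subst (toℕ c ℕ.<_) (sym j≡k) c<k))
                  (sym (toℕ-punchIn-< j' c (subst (toℕ c ℕ.<_) (sym j'≡k+1) (ℕP.m<n⇒m<1+n c<k)))))))
    ... | tri≈ _ c≡k _ = ≈-sym (equal (suc r) (punchIn j' c) (punchIn j c)
           (trans (toℕ-punchIn-< j' c (subst (toℕ c ℕ.<_) (sym j'≡k+1) (subst (ℕ._< suc k) (sym c≡k) (ℕP.n<1+n k)))) c≡k)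
           (trans (toℕ-punchIn-≥ j c (subst (ℕ._≤ toℕ c) (sym j≡k) (ℕP.≤-reflexive (sym c≡k)))) (cong suc c≡k)))
    ... | tri> _ _ c>k = ≡⇒≈ (cong (M (suc r)) (FinP.toℕ-injective
           (trans (toℕ-punchIn-≥ j c (subst (ℕ._≤ toℕ c) (sym j≡k) (ℕP.<⇒≤ c>k)))
                  (sym (toℕ-punchIn-≥ j' c (subst (ℕ._≤ toℕ c) (sym j'≡k+1) c>k))))))

det-addAdjacentColumn : ∀ n k → suc k ℕ.< n → (N M : PM n) (l : ℤ) →
  (∀ r c → toℕ c ≢ k → N r c ≈ M r c) →
  (∀ r c c' → toℕ c ≡ k → toℕ c' ≡ suc k → N r c ≈ M r c +P scaleP l (M r c')) → det n N ≈ det n M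
det-addAdjacentColumn n k k+1<n N M l N≈M N≈M+lM' = begin
  det n N                            ≈⟨ det-linear n k (ℕP.<-trans (ℕP.n<1+n k) k+1<n) N M V l N≈M N≈V N≈M+lV ⟩
  det n M +P scaleP l (det n V)      ≈⟨ +P-cong (≈-refl {det n M}) (scaleP-zeroʳ l (det-adjacentEqualColumns n k k+1<n V V-equal)) ⟩
  det n M +P []                      ≈⟨ +P-identityʳ (det n M) ⟩
  det n M                            ∎
  where
  open ≈-Reasoning
  next : Fin n
  next = fromℕ< k+1<n
  V : PM n
  V r c with toℕ c ℕ.≟ k
  ... | yes _ = M r next
  ... | no _  = M r c
  V-other : ∀ r c → toℕ c ≢ k → V r c ≡ M r c
  V-other r c c≢k with toℕ c ℕ.≟ k
  ... | yes c≡k = contradiction c≡k c≢k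
  ... | no _    = refl
  V-at : ∀ r c → toℕ c ≡ k → V r c ≡ M r next
  V-at r c c≡k with toℕ c ℕ.≟ k
  ... | yes _   = refl
  ... | no c≢k  = contradiction c≡k c≢k
  N≈V : ∀ r c → toℕ c ≢ k → N r c ≈ V r c
  N≈V r c c≢k = ≈-trans (N≈M r c c≢k) (≡⇒≈ (sym (V-other r c c≢k)))
  N≈M+lV : ∀ r c → toℕ c ≡ k → N r c ≈ M r c +P scaleP l (V r c)
  N≈M+lV r c c≡k = ≈-trans (N≈M+lM' r c next c≡k (FinP.toℕ-fromℕ< k+1<n))
                           (≡⇒≈ (cong (λ z → M r c +P scaleP l z) (sym (V-at r c c≡k))))
  V-equal : ∀ r c c' → toℕ c ≡ k → toℕ c' ≡ suc k → V r c ≈ V r c'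
  V-equal r c c' c≡k c'≡k+1 = ≡⇒≈ (trans (V-at r c c≡k) (trans
    (cong (M r) (FinP.toℕ-injective (trans (FinP.toℕ-fromℕ< k+1<n) (sym c'≡k+1))))
    (sym (V-other r c' (λ c'≡k → ℕP.1+n≢n (trans (sym c'≡k+1) c'≡k))))))

det-zeroColumn : ∀ n (M : PM (suc n)) → (∀ r → M r zero ≈ []) → det (suc n) M ≈ []

minor-zeroColumn : ∀ n (M : PM (suc n)) j → (∀ r → M (suc r) zero ≈ []) → det n (minor M (suc j)) ≈ []
minor-zeroColumn (suc n) M j zero-col = det-zeroColumn n (minor M (suc j)) zero-col

det-zeroColumn n M zero-col = ≈-trans (det-laplace n M) (ΣP-zero (suc n) term≈[])
  where
  term≈[] : ∀ j → laplaceTerm n M j ≈ []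
  term≈[] zero    = scaleP-zeroʳ _ (*P-zeroˡ _ (zero-col zero))
  term≈[] (suc j) = scaleP-zeroʳ _ (≈-trans
    (*P-congʳ (M zero (suc j)) (minor-zeroColumn n M j (λ r → zero-col (suc r)))) (*P-zeroʳ (M zero (suc j))))

ΠP : ∀ n → (Fin n → Poly) → Poly
ΠP = foldFin _*P_ 1P

det-upperTriangular : ∀ n (M : PM n) → (∀ r c → toℕ c ℕ.< toℕ r → M r c ≈ []) → det n M ≈ ΠP n (λ i → M i i)
det-upperTriangular zero    M lower≈[] = ≈-refl
det-upperTriangular (suc n) M lower≈[] =
  ≈-trans (det-laplace n M) (≈-trans (+P-cong first-term (ΣP-zero n later-term)) (+P-identityʳ _))
  where
  first-term : laplaceTerm n M zero ≈ M zero zero *P ΠP n (λ i → M (suc i) (suc i))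
  first-term = ≈-trans (scaleP-identity _)
    (*P-congʳ (M zero zero) (det-upperTriangular n (minor M zero) (λ r c c<r → lower≈[] (suc r) (suc c) (s<s c<r))))
  later-term : ∀ j → laplaceTerm n M (suc j) ≈ []
  later-term j = scaleP-zeroʳ _ (≈-trans
    (*P-congʳ (M zero (suc j)) (minor-zeroColumn n M j (λ r → lower≈[] (suc r) zero z<s))) (*P-zeroʳ (M zero (suc j))))

ΣP-++ : ∀ a b (f : Fin (a ℕ.+ b) → Poly) → ΣP (a ℕ.+ b) f ≈ ΣP a (λ j → f (j ↑ˡ b)) +P ΣP b (λ c → f (a ↑ʳ c))
ΣP-++ zero    b f = ≈-refl
ΣP-++ (suc a) b f = ≈-trans (+P-cong (≈-refl {f zero}) (ΣP-++ a b (λ j → f (suc j))))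
  (≈-sym (+P-assoc (f zero) (ΣP a (λ j → f (suc (j ↑ˡ b)))) (ΣP b (λ c → f (suc (a ↑ʳ c))))))

punchIn-↑ˡ-↑ʳ : ∀ {a} b (j : Fin (suc a)) (c : Fin b) → punchIn (j ↑ˡ b) (a ↑ʳ c) ≡ suc a ↑ʳ c
punchIn-↑ˡ-↑ʳ b zero    c = refl
punchIn-↑ˡ-↑ʳ {suc a} b (suc j) c = cong suc (punchIn-↑ˡ-↑ʳ b j c)

punchIn-↑ˡ-↑ˡ : ∀ {a} b (j : Fin (suc a)) (c : Fin a) → punchIn (j ↑ˡ b) (c ↑ˡ b) ≡ punchIn j c ↑ˡ b
punchIn-↑ˡ-↑ˡ b zero    c       = refl
punchIn-↑ˡ-↑ˡ b (suc j) zero    = refl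
punchIn-↑ˡ-↑ˡ b (suc j) (suc c) = cong suc (punchIn-↑ˡ-↑ˡ b j c)

-- A matrix [A 0; C D] with square diagonal blocks A (a × a) and D (b × b).
det-blockLowerTriangular : ∀ a b (M : PM (a ℕ.+ b)) → (∀ r c → M (r ↑ˡ b) (a ↑ʳ c) ≈ []) →
  det (a ℕ.+ b) M ≈ det a (λ r c → M (r ↑ˡ b) (c ↑ˡ b)) *P det b (λ r c → M (a ↑ʳ r) (a ↑ʳ c))
det-blockLowerTriangular zero    b M upper≈[] = ≈-sym (*P-identityˡ _)
det-blockLowerTriangular (suc a) b M upper≈[] = begin
  det (suc a ℕ.+ b) M                                          ≈⟨ det-laplace (a ℕ.+ b) M ⟩
  ΣP (suc a ℕ.+ b) (laplaceTerm (a ℕ.+ b) M)                   ≈⟨ ΣP-++ (suc a) b (laplaceTerm (a ℕ.+ b) M) ⟩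
  ΣP (suc a) (λ j → laplaceTerm (a ℕ.+ b) M (j ↑ˡ b))
    +P ΣP b (λ c → laplaceTerm (a ℕ.+ b) M (suc a ↑ʳ c))      ≈⟨ +P-cong (ΣP-cong (suc a) left-term) (ΣP-zero b right-term) ⟩
  ΣP (suc a) (λ j → laplaceTerm a A j *P det b D) +P []        ≈⟨ +P-identityʳ _ ⟩
  ΣP (suc a) (λ j → laplaceTerm a A j *P det b D)              ≈⟨ ΣP-*P (suc a) (laplaceTerm a A) (det b D) ⟩
  ΣP (suc a) (laplaceTerm a A) *P det b D                      ≈⟨ *P-congˡ (det b D) (det-laplace a A) ⟨
  det (suc a) A *P det b D                                     ∎
  where
  open ≈-Reasoning
  A : PM (suc a)
  A r c = M (r ↑ˡ b) (c ↑ˡ b)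
  D : PM b
  D r c = M (suc a ↑ʳ r) (suc a ↑ʳ c)
  right-term : ∀ c → laplaceTerm (a ℕ.+ b) M (suc a ↑ʳ c) ≈ []
  right-term c = scaleP-zeroʳ _ (*P-zeroˡ _ (upper≈[] zero c))
  left-term : ∀ j → laplaceTerm (a ℕ.+ b) M (j ↑ˡ b) ≈ laplaceTerm a A j *P det b D
  left-term j = begin
    scaleP (altSign (toℕ (j ↑ˡ b))) (A zero j *P det (a ℕ.+ b) (minor M (j ↑ˡ b)))
                       ≈⟨ scaleP-cong (cong altSign (FinP.toℕ-↑ˡ j b)) (*P-congʳ (A zero j) minor-block) ⟩
    scaleP (altSign (toℕ j)) (A zero j *P (det a (minor A j) *P det b D))
                       ≈⟨ scaleP-congʳ (altSign (toℕ j)) (*P-assoc (A zero j) (det a (minor A j)) (det b D)) ⟨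
    scaleP (altSign (toℕ j)) ((A zero j *P det a (minor A j)) *P det b D)
                       ≈⟨ scaleP-*Pˡ (altSign (toℕ j)) (A zero j *P det a (minor A j)) (det b D) ⟨
    laplaceTerm a A j *P det b D ∎
    where
    minor-block : det (a ℕ.+ b) (minor M (j ↑ˡ b)) ≈ det a (minor A j) *P det b D
    minor-block = ≈-trans
      (det-blockLowerTriangular a b (minor M (j ↑ˡ b))
        (λ r c → subst (λ z → M (suc (r ↑ˡ b)) z ≈ []) (sym (punchIn-↑ˡ-↑ʳ b j c)) (upper≈[] (suc r) c)))
      (*P-cong (det-cong a (λ r c → ≡⇒≈ (cong (M (suc r ↑ˡ b)) (punchIn-↑ˡ-↑ˡ b j c))))
               (det-cong b (λ r c → ≡⇒≈ (cong (M (suc (a ↑ʳ r))) (punchIn-↑ˡ-↑ʳ b j c)))))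

ΠP-const : ∀ n {f : Fin n → Poly} {e} → (∀ i → f i ≈ e) → ΠP n f ≈ e ^P n
ΠP-const zero    h = ≈-refl
ΠP-const (suc n) h = *P-cong (h zero) (ΠP-const n (λ i → h (suc i)))

altSign-^P-negP : ∀ k e → scaleP (altSign k) (negP e ^P k) ≈ e ^P k
altSign-^P-negP zero    e = scaleP-identity _
altSign-^P-negP (suc k) e = begin
  scaleP (altSign (suc k)) (negP e *P (negP e ^P k))       ≈⟨ scaleP-cong (trans (altSign-suc k) (sym (ℤP.-1*i≡-i _))) ≈-refl ⟩
  scaleP (ℤ.- + 1 ℤ.* altSign k) (negP e *P (negP e ^P k)) ≈⟨ scaleP-assoc (ℤ.- + 1) (altSign k) _ ⟨
  negP (scaleP (altSign k) (negP e *P (negP e ^P k)))      ≈⟨ scaleP-congʳ (ℤ.- + 1) (scaleP-*Pʳ (altSign k) (negP e) _) ⟨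
  negP (negP e *P scaleP (altSign k) (negP e ^P k))        ≈⟨ scaleP-congʳ (ℤ.- + 1) (*P-congʳ (negP e) (altSign-^P-negP k e)) ⟩
  negP (negP e *P (e ^P k))                                ≈⟨ scaleP-*Pˡ (ℤ.- + 1) (negP e) (e ^P k) ⟨
  negP (negP e) *P (e ^P k)                                ≈⟨ *P-congˡ (e ^P k) (≈-trans (scaleP-assoc (ℤ.- + 1) (ℤ.- + 1) e) (scaleP-identity e)) ⟩
  e *P (e ^P k)                                            ∎
  where open ≈-Reasoning

-P-antisym : ∀ p q → q -P p ≈ negP (p -P q)
-P-antisym p q = ⟨ (λ k → begin≡
  coeff (q -P p) k                              ≡⟨ coeff-+P q (negP p) k ⟩
  coeff q k ℤ.+ coeff (negP p) k                ≡⟨ cong (λ z → coeff q k ℤ.+ z) (coeff-negP p k) ⟩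
  coeff q k ℤ.- coeff p k                       ≡⟨ ℤP.+-comm (coeff q k) _ ⟩
  ℤ.- coeff p k ℤ.+ coeff q k                   ≡⟨ cong (λ z → ℤ.- coeff p k ℤ.+ z) (ℤP.neg-involutive (coeff q k)) ⟨
  ℤ.- coeff p k ℤ.- ℤ.- coeff q k               ≡⟨ ℤP.neg-distrib-+ (coeff p k) (ℤ.- coeff q k) ⟨
  ℤ.- (coeff p k ℤ.- coeff q k)                 ≡⟨ cong (λ z → ℤ.- (coeff p k ℤ.+ z)) (coeff-negP q k) ⟨
  ℤ.- (coeff p k ℤ.+ coeff (negP q) k)          ≡⟨ cong ℤ.-_ (coeff-+P p (negP q) k) ⟨
  ℤ.- coeff (p -P q) k                          ≡⟨ coeff-negP (p -P q) k ⟨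
  coeff (negP (p -P q)) k                       ∎≡) ⟩
  where open ≡-Reasoning renaming (begin_ to begin≡_; _∎ to _∎≡)

module _ (α β : Poly) where

  U : ℕ → ℕ → Poly
  U r c = if does (r ℕ.≟ c) then α else β

  -- U with each of its first i columns c replaced by (column c) − (column c+1).
  Uᵢ : ∀ p → ℕ → PM p
  Uᵢ p i r c = if does (toℕ c ℕ.<? i) then U (toℕ r) (toℕ c) -P U (toℕ r) (suc (toℕ c)) else U (toℕ r) (toℕ c)

  Uᵢ-step : ∀ p i → suc i ℕ.< p → det p (Uᵢ p (suc i)) ≈ det p (Uᵢ p i)
  Uᵢ-step p i i+1<p = det-addAdjacentColumn p i i+1<p (Uᵢ p (suc i)) (Uᵢ p i) (ℤ.- + 1) other-column column-i
    where
    other-column : ∀ r c → toℕ c ≢ i → Uᵢ p (suc i) r c ≈ Uᵢ p i r c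
    other-column r c c≢i with ℕP.<-cmp (toℕ c) i
    ... | tri< c<i _ _ rewrite dec-true (toℕ c ℕ.<? i) c<i | dec-true (toℕ c ℕ.<? suc i) (ℕP.m<n⇒m<1+n c<i) = ≈-refl
    ... | tri≈ _ c≡i _ = contradiction c≡i c≢i
    ... | tri> _ _ c>i rewrite dec-false (toℕ c ℕ.<? i) (ℕP.<⇒≯ c>i) | dec-false (toℕ c ℕ.<? suc i) (ℕP.≤⇒≯ c>i) = ≈-refl
    column-i : ∀ r c c' → toℕ c ≡ i → toℕ c' ≡ suc i → Uᵢ p (suc i) r c ≈ Uᵢ p i r c +P scaleP (ℤ.- + 1) (Uᵢ p i r c')
    column-i r c c' refl c'≡i+1
      rewrite c'≡i+1 | dec-true (toℕ c ℕ.<? suc (toℕ c)) (ℕP.n<1+n (toℕ c)) | dec-false (toℕ c ℕ.<? toℕ c) (ℕP.<-irrefl refl)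
            | dec-false (suc (toℕ c) ℕ.<? toℕ c) (ℕP.<-asym (ℕP.n<1+n (toℕ c))) = ≈-refl

  det-Uᵢ≈det-U₀ : ∀ p i → i ℕ.< p → det p (Uᵢ p i) ≈ det p (Uᵢ p 0)
  det-Uᵢ≈det-U₀ p zero    i<p = ≈-refl
  det-Uᵢ≈det-U₀ p (suc i) i<p = ≈-trans (Uᵢ-step p i i<p) (det-Uᵢ≈det-U₀ p i (ℕP.<-trans (ℕP.n<1+n i) i<p))

  lastMinor-entry : ∀ q (r c : Fin (suc q)) →
    minor (Uᵢ (suc (suc q)) (suc q)) (fromℕ (suc q)) r c ≡ U (suc (toℕ r)) (toℕ c) -P U (suc (toℕ r)) (suc (toℕ c))
  lastMinor-entry q r c
    rewrite toℕ-punchIn-< (fromℕ (suc q)) c (subst (toℕ c ℕ.<_) (sym (FinP.toℕ-fromℕ (suc q))) (FinP.toℕ<n c))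
          | dec-true (toℕ c ℕ.<? suc q) (FinP.toℕ<n c) = refl

  det-lastMinor : ∀ q → det (suc q) (minor (Uᵢ (suc (suc q)) (suc q)) (fromℕ (suc q))) ≈ (β -P α) ^P suc q
  det-lastMinor q = ≈-trans (det-upperTriangular (suc q) _ below-diagonal) (ΠP-const (suc q) diagonal)
    where
    below-diagonal : ∀ r c → toℕ c ℕ.< toℕ r → minor (Uᵢ (suc (suc q)) (suc q)) (fromℕ (suc q)) r c ≈ []
    below-diagonal r c c<r
      rewrite lastMinor-entry q r c
            | dec-false (suc (toℕ r) ℕ.≟ toℕ c) (λ r+1≡c → ℕP.<-asym c<r (subst (toℕ r ℕ.<_) r+1≡c (ℕP.n<1+n (toℕ r))))
            | dec-false (toℕ r ℕ.≟ toℕ c) (λ r≡c → ℕP.<-irrefl (sym r≡c) c<r) = +P-inverseʳ β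
    diagonal : ∀ i → minor (Uᵢ (suc (suc q)) (suc q)) (fromℕ (suc q)) i i ≈ β -P α
    diagonal i
      rewrite lastMinor-entry q i i
            | dec-false (suc (toℕ i) ℕ.≟ toℕ i) ℕP.1+n≢n
            | dec-true (toℕ i ℕ.≟ toℕ i) refl = ≈-refl

  -- After the column operations the first row is (α - β, 0, …, 0, β); the minor of its first
  -- entry is the same matrix one size smaller, that of its last entry is upper triangular.
  det-Uᵢ-recurrence : ∀ q → det (suc (suc q)) (Uᵢ (suc (suc q)) (suc q)) ≈
                            ((α -P β) *P det (suc q) (Uᵢ (suc q) q)) +P (β *P ((α -P β) ^P suc q))
  det-Uᵢ-recurrence q = ≈-trans (det-laplace (suc q) M)
    (+P-cong (scaleP-identity ((α -P β) *P det (suc q) (Uᵢ (suc q) q)))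
             (≈-trans (ΣP-single (suc q) (λ j → laplaceTerm (suc q) M (suc j)) (fromℕ q) middle-term) last-term))
    where
    M = Uᵢ (suc (suc q)) (suc q)
    middle-term : ∀ j → j ≢ fromℕ q → laplaceTerm (suc q) M (suc j) ≈ []
    middle-term j j≢q = scaleP-zeroʳ _ (*P-zeroˡ _ entry≈[])
      where
      j<q : toℕ j ℕ.< q
      j<q = ℕP.≤∧≢⇒< (ℕP.≤-pred (FinP.toℕ<n j)) (λ j≡q → j≢q (FinP.toℕ-injective (trans j≡q (sym (FinP.toℕ-fromℕ q)))))
      entry≈[] : M zero (suc j) ≈ []
      entry≈[] rewrite dec-true (toℕ j ℕ.<? q) j<q = +P-inverseʳ β
    last-term : laplaceTerm (suc q) M (fromℕ (suc q)) ≈ β *P ((α -P β) ^P suc q)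
    last-term = begin
      scaleP (altSign (toℕ (fromℕ (suc q)))) (M zero (fromℕ (suc q)) *P det (suc q) (minor M (fromℕ (suc q))))
        ≈⟨ scaleP-cong (cong altSign (FinP.toℕ-fromℕ (suc q))) (*P-cong last-entry (det-lastMinor q)) ⟩
      scaleP (altSign (suc q)) (β *P ((β -P α) ^P suc q))
        ≈⟨ scaleP-*Pʳ (altSign (suc q)) β _ ⟨
      β *P scaleP (altSign (suc q)) ((β -P α) ^P suc q)
        ≈⟨ *P-congʳ β (≈-trans (scaleP-congʳ _ (^P-cong (suc q) (-P-antisym α β))) (altSign-^P-negP (suc q) (α -P β))) ⟩
      β *P ((α -P β) ^P suc q) ∎
      where
      open ≈-Reasoning
      last-entry : M zero (fromℕ (suc q)) ≈ β
      last-entry rewrite FinP.toℕ-fromℕ q | dec-false (q ℕ.<? q) (ℕP.<-irrefl refl) = ≈-refl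

  det-Uᵢ : ∀ q → det (suc q) (Uᵢ (suc q) q) ≈ ((α -P β) ^P q) *P (α +P scaleP (+ q) β)
  det-Uᵢ zero = begin
    det 1 (Uᵢ 1 0)                 ≈⟨ det-laplace zero (Uᵢ 1 0) ⟩
    scaleP (+ 1) (α *P 1P) +P []   ≈⟨ +P-identityʳ _ ⟩
    scaleP (+ 1) (α *P 1P)         ≈⟨ scaleP-identity _ ⟩
    α *P 1P                        ≈⟨ *P-identityʳ α ⟩
    α                              ≈⟨ +P-identityʳ α ⟨
    α +P []                        ≈⟨ +P-cong (≈-refl {α}) (scaleP-zeroˡ β) ⟨
    α +P scaleP (+ 0) β            ≈⟨ *P-identityˡ _ ⟨
    1P *P (α +P scaleP (+ 0) β)    ∎
    where open ≈-Reasoning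
  det-Uᵢ (suc q) = begin
    det (suc (suc q)) (Uᵢ (suc (suc q)) (suc q))
      ≈⟨ det-Uᵢ-recurrence q ⟩
    (e *P det (suc q) (Uᵢ (suc q) q)) +P (β *P (e ^P suc q))
      ≈⟨ +P-cong (*P-congʳ e (det-Uᵢ q)) (*P-comm β (e ^P suc q)) ⟩
    (e *P ((e ^P q) *P X)) +P ((e ^P suc q) *P β)
      ≈⟨ +P-cong (*P-assoc e (e ^P q) X) (≈-refl {(e ^P suc q) *P β}) ⟨
    ((e ^P suc q) *P X) +P ((e ^P suc q) *P β)
      ≈⟨ *P-distribˡ (e ^P suc q) X β ⟨
    (e ^P suc q) *P (X +P β)
      ≈⟨ *P-congʳ (e ^P suc q) X+β ⟩
    (e ^P suc q) *P (α +P scaleP (+ suc q) β) ∎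
    where
    open ≈-Reasoning
    e = α -P β
    X = α +P scaleP (+ q) β
    X+β : X +P β ≈ α +P scaleP (+ suc q) β
    X+β = begin
      (α +P scaleP (+ q) β) +P β                 ≈⟨ +P-assoc α (scaleP (+ q) β) β ⟩
      α +P (scaleP (+ q) β +P β)                 ≈⟨ +P-cong (≈-refl {α}) (+P-cong (≈-refl {scaleP (+ q) β}) (scaleP-identity β)) ⟨
      α +P (scaleP (+ q) β +P scaleP (+ 1) β)    ≈⟨ +P-cong (≈-refl {α}) (scaleP-distribʳ (+ q) (+ 1) β) ⟨
      α +P scaleP (+ q ℤ.+ + 1) β                ≈⟨ +P-cong (≈-refl {α}) (scaleP-cong (cong +_ (ℕP.+-comm q 1)) ≈-refl) ⟩
      α +P scaleP (+ suc q) β                    ∎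

det-uniform : ∀ q (α β : Poly) → det (suc q) (λ r c → if eq? r c then α else β) ≈ ((α -P β) ^P q) *P (α +P scaleP (+ q) β)
det-uniform q α β = begin
  det (suc q) (λ r c → if eq? r c then α else β)  ≈⟨ det-cong (suc q) by-positions ⟩
  det (suc q) (Uᵢ α β (suc q) 0)                   ≈⟨ det-Uᵢ≈det-U₀ α β (suc q) q (ℕP.n<1+n q) ⟨
  det (suc q) (Uᵢ α β (suc q) q)                   ≈⟨ det-Uᵢ α β q ⟩
  ((α -P β) ^P q) *P (α +P scaleP (+ q) β)         ∎
  where
  open ≈-Reasoning
  by-positions : ∀ r c → (if eq? r c then α else β) ≈ Uᵢ α β (suc q) 0 r c
  by-positions r c with r FinP.≟ c
  ... | yes refl rewrite dec-true (toℕ r ℕ.≟ toℕ r) refl = ≈-refl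
  ... | no r≢c   rewrite dec-false (toℕ r ℕ.≟ toℕ c) (r≢c ∘ FinP.toℕ-injective) = ≈-refl

lin : ℤ → Poly
lin l = ℤ.- l ∷ + 1 ∷ []

prodLin-replicate : ∀ q l → prodLin (replicate q l) ≡ lin l ^P q
prodLin-replicate zero    l = refl
prodLin-replicate (suc q) l = cong (lin l *P_) (prodLin-replicate q l)

prodLin-++ : ∀ L L' → prodLin (L ++ L') ≈ prodLin L *P prodLin L'
prodLin-++ []      L' = ≈-sym (*P-identityˡ _)
prodLin-++ (l ∷ L) L' = ≈-trans (*P-congʳ (lin l) (prodLin-++ L L')) (≈-sym (*P-assoc (lin l) (prodLin L) (prodLin L')))

prodLin-↭ : ∀ {L L'} → L ↭ L' → prodLin L ≈ prodLin L'
prodLin-↭ ↭.refl         = ≈-refl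
prodLin-↭ (↭.prep l p)   = *P-congʳ (lin l) (prodLin-↭ p)
prodLin-↭ (↭.swap {xs} {ys} l l' p) = begin
  lin l *P (lin l' *P prodLin xs)   ≈⟨ *P-assoc (lin l) (lin l') (prodLin xs) ⟨
  (lin l *P lin l') *P prodLin xs   ≈⟨ *P-congˡ (prodLin xs) (*P-comm (lin l) (lin l')) ⟩
  (lin l' *P lin l) *P prodLin xs   ≈⟨ *P-assoc (lin l') (lin l) (prodLin xs) ⟩
  lin l' *P (lin l *P prodLin xs)   ≈⟨ *P-congʳ (lin l') (*P-congʳ (lin l) (prodLin-↭ p)) ⟩
  lin l' *P (lin l *P prodLin ys)   ∎
  where open ≈-Reasoning
prodLin-↭ (↭.trans p q)  = ≈-trans (prodLin-↭ p) (prodLin-↭ q)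

charPM : ∀ {p} → Mat p → PM p
charPM M i j = if eq? i j then ℤ.- M i j ∷ + 1 ∷ [] else ℤ.- M i j ∷ []

charPoly-uniform : ∀ q (M : Mat (suc q)) d o {x l} → (∀ i j → M i j ≡ (if eq? i j then d else o)) →
  x ≡ d ℤ.+ + q ℤ.* o → l ≡ d ℤ.- o → charPoly M ≈ prodLin (x ∷ replicate q l)
charPoly-uniform q M d o {x} {l} M-uniform x≡ l≡ = begin
  det (suc q) (charPM M)                                         ≈⟨ det-cong (suc q) entries ⟩
  det (suc q) (λ i j → if eq? i j then lin d else ℤ.- o ∷ [])    ≈⟨ det-uniform q (lin d) (ℤ.- o ∷ []) ⟩
  ((lin d -P (ℤ.- o ∷ [])) ^P q) *P (lin d +P scaleP (+ q) (ℤ.- o ∷ []))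
                                                                 ≈⟨ *P-cong (^P-cong q (∷-cong difference ≈-refl)) (∷-cong total ≈-refl) ⟩
  (lin l ^P q) *P lin x                                          ≈⟨ *P-comm (lin l ^P q) (lin x) ⟩
  lin x *P (lin l ^P q)                                          ≈⟨ ≡⇒≈ (cong (lin x *P_) (prodLin-replicate q l)) ⟨
  prodLin (x ∷ replicate q l)                                    ∎
  where
  open ≈-Reasoning
  entries : ∀ i j → charPM M i j ≈ (if eq? i j then lin d else ℤ.- o ∷ [])
  entries i j rewrite M-uniform i j with eq? i j
  ... | true  = ≈-refl
  ... | false = ≈-refl
  difference : ℤ.- d ℤ.+ ℤ.- + 1 ℤ.* ℤ.- o ≡ ℤ.- l
  difference rewrite l≡ = identity d o
    where
    identity : ∀ d o → ℤ.- d ℤ.+ ℤ.- + 1 ℤ.* ℤ.- o ≡ ℤ.- (d ℤ.- o)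
    identity = solve-∀
  total : ℤ.- d ℤ.+ + q ℤ.* ℤ.- o ≡ ℤ.- x
  total rewrite x≡ = identity d o (+ q)
    where
    identity : ∀ d o q → ℤ.- d ℤ.+ q ℤ.* ℤ.- o ≡ ℤ.- (d ℤ.+ q ℤ.* o)
    identity = solve-∀

charPoly-blockUniform : ∀ m n (M : Mat (suc m ℕ.+ suc n)) dA oA dB oB {xA lA xB lB} →
  (∀ x y → M (x ↑ˡ suc n) (y ↑ˡ suc n) ≡ (if eq? x y then dA else oA)) →
  (∀ x y → M (suc m ↑ʳ x) (suc m ↑ʳ y) ≡ (if eq? x y then dB else oB)) →
  (∀ x y → M (x ↑ˡ suc n) (suc m ↑ʳ y) ≡ + 0) →
  xA ≡ dA ℤ.+ + m ℤ.* oA → lA ≡ dA ℤ.- oA → xB ≡ dB ℤ.+ + n ℤ.* oB → lB ≡ dB ℤ.- oB →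
  charPoly M ≈ prodLin ((xA ∷ replicate m lA) ++ (xB ∷ replicate n lB))
charPoly-blockUniform m n M dA oA dB oB {xA} {lA} {xB} {lB} A-uniform B-uniform corner≡0 xA≡ lA≡ xB≡ lB≡ = begin
  det (suc m ℕ.+ suc n) (charPM M)
    ≈⟨ det-blockLowerTriangular (suc m) (suc n) (charPM M) corner ⟩
  det (suc m) (λ x y → charPM M (x ↑ˡ suc n) (y ↑ˡ suc n)) *P det (suc n) (λ x y → charPM M (suc m ↑ʳ x) (suc m ↑ʳ y))
    ≈⟨ *P-cong (det-cong (suc m) (λ x y → ≡⇒≈ (cong (charEntry (A x y)) (eq?-↑ˡ (suc n) x y))))
               (det-cong (suc n) (λ x y → ≡⇒≈ (cong (charEntry (B x y)) (eq?-↑ʳ (suc m) x y)))) ⟩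
  charPoly A *P charPoly B
    ≈⟨ *P-cong (charPoly-uniform m A dA oA A-uniform xA≡ lA≡) (charPoly-uniform n B dB oB B-uniform xB≡ lB≡) ⟩
  prodLin (xA ∷ replicate m lA) *P prodLin (xB ∷ replicate n lB)
    ≈⟨ prodLin-++ (xA ∷ replicate m lA) (xB ∷ replicate n lB) ⟨
  prodLin ((xA ∷ replicate m lA) ++ (xB ∷ replicate n lB)) ∎
  where
  open ≈-Reasoning
  A : Mat (suc m)
  A x y = M (x ↑ˡ suc n) (y ↑ˡ suc n)
  B : Mat (suc n)
  B x y = M (suc m ↑ʳ x) (suc m ↑ʳ y)
  charEntry : ℤ → Bool → Poly
  charEntry a b = if b then ℤ.- a ∷ + 1 ∷ [] else ℤ.- a ∷ []
  corner : ∀ x y → charPM M (x ↑ˡ suc n) (suc m ↑ʳ y) ≈ []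
  corner x y = ≈-trans
    (≡⇒≈ (trans (cong (charEntry (M (x ↑ˡ suc n) (suc m ↑ʳ y))) (eq?-↑ˡ-↑ʳ x y)) (cong (λ a → ℤ.- a ∷ []) (corner≡0 x y))))
    (shift-≈[] ≈-refl)

eval : Poly → ℤ → ℤ
eval []      x = + 0
eval (a ∷ p) x = a ℤ.+ x ℤ.* eval p x

eval-≈[] : ∀ {p} x → p ≈ [] → eval p x ≡ + 0
eval-≈[] {[]}    x h = refl
eval-≈[] {a ∷ p} x h = trans (cong₂ (λ u v → u ℤ.+ x ℤ.* v) (coeff-≡ h 0) (eval-≈[] {p} x ⟨ (λ k → coeff-≡ h (suc k)) ⟩))
                              (trans (ℤP.+-identityˡ _) (ℤP.*-zeroʳ x))

eval-cong : ∀ {p q} x → p ≈ q → eval p x ≡ eval q x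
eval-cong {[]}    {q}     x h = sym (eval-≈[] x (≈-sym h))
eval-cong {a ∷ p} {[]}    x h = eval-≈[] x h
eval-cong {a ∷ p} {b ∷ q} x h = cong₂ (λ u v → u ℤ.+ x ℤ.* v) (coeff-≡ h 0) (eval-cong x (∷-tail h))

eval-+P : ∀ p q x → eval (p +P q) x ≡ eval p x ℤ.+ eval q x
eval-+P []      q       x = sym (ℤP.+-identityˡ _)
eval-+P (a ∷ p) []      x = sym (ℤP.+-identityʳ _)
eval-+P (a ∷ p) (b ∷ q) x = trans (cong (λ z → a ℤ.+ b ℤ.+ x ℤ.* z) (eval-+P p q x)) (identity a b x (eval p x) (eval q x))
  where
  identity : ∀ a b x u v → a ℤ.+ b ℤ.+ x ℤ.* (u ℤ.+ v) ≡ a ℤ.+ x ℤ.* u ℤ.+ (b ℤ.+ x ℤ.* v)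
  identity = solve-∀

eval-scaleP : ∀ c p x → eval (scaleP c p) x ≡ c ℤ.* eval p x
eval-scaleP c []      x = sym (ℤP.*-zeroʳ c)
eval-scaleP c (a ∷ p) x = trans (cong (λ z → c ℤ.* a ℤ.+ x ℤ.* z) (eval-scaleP c p x)) (identity c a x (eval p x))
  where
  identity : ∀ c a x u → c ℤ.* a ℤ.+ x ℤ.* (c ℤ.* u) ≡ c ℤ.* (a ℤ.+ x ℤ.* u)
  identity = solve-∀

eval-*P : ∀ p q x → eval (p *P q) x ≡ eval p x ℤ.* eval q x
eval-*P []      q x = refl
eval-*P (a ∷ p) q x = trans (eval-+P (scaleP a q) (+ 0 ∷ (p *P q)) x)
  (trans (cong₂ (λ u v → u ℤ.+ (+ 0 ℤ.+ x ℤ.* v)) (eval-scaleP a q x) (eval-*P p q x)) (identity a x (eval p x) (eval q x)))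
  where
  identity : ∀ a x u v → a ℤ.* v ℤ.+ (+ 0 ℤ.+ x ℤ.* (u ℤ.* v)) ≡ (a ℤ.+ x ℤ.* u) ℤ.* v
  identity = solve-∀

eval-lin : ∀ l x → eval (lin l) x ≡ x ℤ.- l
eval-lin = identity
  where
  identity : ∀ l x → ℤ.- l ℤ.+ x ℤ.* (+ 1 ℤ.+ x ℤ.* + 0) ≡ x ℤ.- l
  identity = solve-∀

eval-prodLin-∷-root : ∀ l L → eval (prodLin (l ∷ L)) l ≡ + 0
eval-prodLin-∷-root l L = begin≡
  eval (lin l *P prodLin L) l          ≡⟨ eval-*P (lin l) (prodLin L) l ⟩
  eval (lin l) l ℤ.* eval (prodLin L) l ≡⟨ cong (ℤ._* eval (prodLin L) l) (trans (eval-lin l l) (ℤP.+-inverseʳ l)) ⟩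
  + 0                                  ∎≡
  where open ≡-Reasoning renaming (begin_ to begin≡_; _∎ to _∎≡)

root⇒↭ : ∀ l L → eval (prodLin L) l ≡ + 0 → Σ[ rest ∈ List ℤ ] L ↭ l ∷ rest
root⇒↭ l []       root = contradiction (trans (cong (λ z → + 1 ℤ.+ z) (sym (ℤP.*-zeroʳ l))) root) λ ()
root⇒↭ l (l' ∷ L) root
  with ℤP.i*j≡0⇒i≡0∨j≡0 (l ℤ.- l') (trans (sym (cong (ℤ._* eval (prodLin L) l) (eval-lin l' l)))
                                            (trans (sym (eval-*P (lin l') (prodLin L) l)) root))
... | inj₁ l-l'≡0 = L , subst (λ z → l' ∷ L ↭ z ∷ L) (sym (ℤP.i-j≡0⇒i≡j l l' l-l'≡0)) ↭.refl
... | inj₂ root' with root⇒↭ l L root'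
...   | rest , L↭ = l' ∷ rest , ↭.trans (↭.prep l' L↭) (↭.swap l' l ↭.refl)

lin*P≈ : ∀ l p → lin l *P p ≈ scaleP (ℤ.- l) p +P (+ 0 ∷ p)
lin*P≈ l p = +P-cong (≈-refl {scaleP (ℤ.- l) p}) (∷-cong refl (*P-identityˡ p))

coeff-lin*P-zero : ∀ l p → coeff (lin l *P p) 0 ≡ ℤ.- l ℤ.* coeff p 0
coeff-lin*P-zero l p = trans (coeff-≡ (lin*P≈ l p) 0)
  (trans (coeff-+P (scaleP (ℤ.- l) p) (+ 0 ∷ p) 0) (trans (ℤP.+-identityʳ _) (coeff-scaleP (ℤ.- l) p 0)))

coeff-lin*P-suc : ∀ l p k → coeff (lin l *P p) (suc k) ≡ ℤ.- l ℤ.* coeff p (suc k) ℤ.+ coeff p k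
coeff-lin*P-suc l p k = trans (coeff-≡ (lin*P≈ l p) (suc k))
  (trans (coeff-+P (scaleP (ℤ.- l) p) (+ 0 ∷ p) (suc k)) (cong (ℤ._+ coeff p k) (coeff-scaleP (ℤ.- l) p (suc k))))

lin*P-cancelˡ : ∀ l {p q} → lin l *P p ≈ lin l *P q → p ≈ q
lin*P-cancelˡ l {p} {q} h with ℤ.- l ℤ.≟ + 0
... | yes -l≡0 = ⟨ (λ k → trans (sym (shifted p k)) (trans (coeff-≡ h (suc k)) (shifted q k))) ⟩
  where
  shifted : ∀ r k → coeff (lin l *P r) (suc k) ≡ coeff r k
  shifted r k = trans (coeff-lin*P-suc l r k)
    (trans (cong (λ w → w ℤ.* coeff r (suc k) ℤ.+ coeff r k) -l≡0) (ℤP.+-identityˡ _))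
... | no -l≢0 = ⟨ go ⟩
  where
  instance _ = ℤ.≢-nonZero -l≢0
  go : ∀ k → coeff p k ≡ coeff q k
  go zero    = ℤP.*-cancelˡ-≡ (ℤ.- l) _ _
    (trans (sym (coeff-lin*P-zero l p)) (trans (coeff-≡ h 0) (coeff-lin*P-zero l q)))
  go (suc k) = ℤP.*-cancelˡ-≡ (ℤ.- l) _ _ (+-cancelʳ (coeff p k) _ _ (begin≡
    ℤ.- l ℤ.* coeff p (suc k) ℤ.+ coeff p k   ≡⟨ coeff-lin*P-suc l p k ⟨
    coeff (lin l *P p) (suc k)               ≡⟨ coeff-≡ h (suc k) ⟩
    coeff (lin l *P q) (suc k)               ≡⟨ coeff-lin*P-suc l q k ⟩
    ℤ.- l ℤ.* coeff q (suc k) ℤ.+ coeff q k   ≡⟨ cong (λ z → ℤ.- l ℤ.* coeff q (suc k) ℤ.+ z) (go k) ⟨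
    ℤ.- l ℤ.* coeff q (suc k) ℤ.+ coeff p k   ∎≡))
    where open ≡-Reasoning renaming (begin_ to begin≡_; _∎ to _∎≡)

prodLin-injective : ∀ L L' → prodLin L ≈ prodLin L' → L ↭ L'
prodLin-injective []      []       h = ↭.refl
prodLin-injective []      (l' ∷ L') h = contradiction
  (trans (cong (λ z → + 1 ℤ.+ z) (sym (ℤP.*-zeroʳ l'))) (trans (eval-cong l' h) (eval-prodLin-∷-root l' L'))) λ ()
prodLin-injective (l ∷ L) L'       h with root⇒↭ l L' (trans (sym (eval-cong l h)) (eval-prodLin-∷-root l L))
... | rest , L'↭ = ↭.trans (↭.prep l (prodLin-injective L rest (lin*P-cancelˡ l (≈-trans h (prodLin-↭ L'↭))))) (↭-sym L'↭)

energyTerm : ℤ → ℤ → ℕ → ℚ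
energyTerm ν t p = ℚ.∣ (ν /ₙ 1) ℚ.- (t /ₙ p) ∣

energy-↭ : ∀ {L L'} t p → L ↭ L' → energy L t p ≡ energy L' t p
energy-↭ t p ↭.refl        = refl
energy-↭ t p (↭.prep ν q)  = cong (energyTerm ν t p ℚ.+_) (energy-↭ t p q)
energy-↭ t p (↭.swap {xs} {ys} ν μ q) = begin
  energyTerm ν t p ℚ.+ (energyTerm μ t p ℚ.+ energy xs t p)  ≡⟨ ℚP.+-assoc (energyTerm ν t p) _ _ ⟨
  (energyTerm ν t p ℚ.+ energyTerm μ t p) ℚ.+ energy xs t p  ≡⟨ cong (ℚ._+ energy xs t p) (ℚP.+-comm (energyTerm ν t p) _) ⟩
  (energyTerm μ t p ℚ.+ energyTerm ν t p) ℚ.+ energy xs t p  ≡⟨ ℚP.+-assoc (energyTerm μ t p) _ _ ⟩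
  energyTerm μ t p ℚ.+ (energyTerm ν t p ℚ.+ energy xs t p)  ≡⟨ cong (λ z → energyTerm μ t p ℚ.+ (energyTerm ν t p ℚ.+ z)) (energy-↭ t p q) ⟩
  energyTerm μ t p ℚ.+ (energyTerm ν t p ℚ.+ energy ys t p)  ∎
  where open ≡-Reasoning
energy-↭ t p (↭.trans q r) = trans (energy-↭ t p q) (energy-↭ t p r)

energy-ofSpectrum : ∀ {p} (M : Mat p) L₀ t → charPoly M ≈ prodLin L₀ →
  ∀ {v} → energy L₀ t p ≡ v → ∀ L → IsSpectrum M L → energy L t p ≡ v
energy-ofSpectrum {p} M L₀ t M-spectrum energy≡v L L-spectrum =
  trans (energy-↭ t p (prodLin-injective L L₀ (≈-trans (≈-sym ⟨ L-spectrum ⟩) M-spectrum))) energy≡v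

-- p · |ν - t/p|, the integer numerator of a term of the energy.
deviation : ℤ → ℕ → ℤ → ℤ
deviation t p ν = + ∣ ν ℤ.* + p ℤ.- t ∣

Σdeviation : List ℤ → ℤ → ℕ → ℤ
Σdeviation []      t p = + 0
Σdeviation (ν ∷ L) t p = deviation t p ν ℤ.+ Σdeviation L t p

Σdeviation-++ : ∀ L L' t p → Σdeviation (L ++ L') t p ≡ Σdeviation L t p ℤ.+ Σdeviation L' t p
Σdeviation-++ []      L' t p = sym (ℤP.+-identityˡ _)
Σdeviation-++ (ν ∷ L) L' t p = trans (cong (λ z → deviation t p ν ℤ.+ z) (Σdeviation-++ L L' t p))
                                       (sym (ℤP.+-assoc (deviation t p ν) (Σdeviation L t p) (Σdeviation L' t p)))

Σdeviation-replicate : ∀ k ν t p → Σdeviation (replicate k ν) t p ≡ + k ℤ.* deviation t p ν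
Σdeviation-replicate zero    ν t p = refl
Σdeviation-replicate (suc k) ν t p = trans (cong (λ z → deviation t p ν ℤ.+ z) (Σdeviation-replicate k ν t p))
                                             (identity (deviation t p ν) (+ k))
  where
  identity : ∀ d k → d ℤ.+ k ℤ.* d ≡ (+ 1 ℤ.+ k) ℤ.* d
  identity = solve-∀

toℚᵘ-/ₙ : ∀ z d → toℚᵘ (z /ₙ suc d) ≃ mkℚᵘ z d
toℚᵘ-/ₙ z d = ℚP.toℚᵘ-fromℚᵘ (mkℚᵘ z d)

/ₙ-≡ : ∀ a b d e → a ℤ.* + suc e ≡ b ℤ.* + suc d → a /ₙ suc d ≡ b /ₙ suc e
/ₙ-≡ a b d e cross = ℚP.toℚᵘ-injective
  (ℚᵘP.≃-trans (toℚᵘ-/ₙ a d) (ℚᵘP.≃-trans (*≡* cross) (ℚᵘP.≃-sym (toℚᵘ-/ₙ b e))))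

toℚᵘ-energyTerm : ∀ ν t d → toℚᵘ (energyTerm ν t (suc d)) ≃ mkℚᵘ (deviation t (suc d) ν) d
toℚᵘ-energyTerm ν t d = ℚᵘP.≃-trans (ℚP.toℚᵘ-homo-∣-∣ ((ν /ₙ 1) ℚ.- (t /ₙ suc d)))
  (ℚᵘP.≃-trans (ℚᵘP.∣-∣-cong difference) (*≡* (cross (identity ν t (+ suc d)) (ℕP.+-identityʳ d))))
  where
  difference : toℚᵘ ((ν /ₙ 1) ℚ.- (t /ₙ suc d)) ≃ mkℚᵘ ν 0 ℚᵘ.- mkℚᵘ t d
  difference = ℚᵘP.≃-trans (ℚP.toℚᵘ-homo-+ (ν /ₙ 1) (ℚ.- (t /ₙ suc d)))
    (ℚᵘP.+-cong (toℚᵘ-/ₙ ν 0) (ℚᵘP.≃-trans (ℚP.toℚᵘ-homo‿- (t /ₙ suc d)) (ℚᵘP.-‿cong (toℚᵘ-/ₙ t d))))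
  identity : ∀ ν t p → ν ℤ.* p ℤ.+ ℤ.- t ℤ.* + 1 ≡ ν ℤ.* p ℤ.- t
  identity = solve-∀
  cross : ∀ {a b : ℤ} {d e : ℕ} → a ≡ b → e ≡ d → + ∣ a ∣ ℤ.* + suc d ≡ + ∣ b ∣ ℤ.* + suc e
  cross refl refl = refl

toℚᵘ-energy : ∀ L t d → toℚᵘ (energy L t (suc d)) ≃ mkℚᵘ (Σdeviation L t (suc d)) d
toℚᵘ-energy []      t d = *≡* refl
toℚᵘ-energy (ν ∷ L) t d = ℚᵘP.≃-trans (ℚP.toℚᵘ-homo-+ (energyTerm ν t (suc d)) (energy L t (suc d)))
  (ℚᵘP.≃-trans (ℚᵘP.+-cong (toℚᵘ-energyTerm ν t d) (toℚᵘ-energy L t d))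
                (*≡* (identity (deviation t (suc d) ν) (Σdeviation L t (suc d)) (+ suc d))))
  where
  identity : ∀ a b p → (a ℤ.* p ℤ.+ b ℤ.* p) ℤ.* p ≡ (a ℤ.+ b) ℤ.* (p ℤ.* p)
  identity = solve-∀

energy≡Σdeviation/ₙ : ∀ L t d → energy L t (suc d) ≡ Σdeviation L t (suc d) /ₙ suc d
energy≡Σdeviation/ₙ L t d = ℚP.toℚᵘ-injective (ℚᵘP.≃-trans (toℚᵘ-energy L t d) (ℚᵘP.≃-sym (toℚᵘ-/ₙ _ d)))

+∣+m*i∣ : ∀ m i → + ∣ + m ℤ.* i ∣ ≡ + m ℤ.* + ∣ i ∣
+∣+m*i∣ m i = trans (cong +_ (ℤP.abs-* (+ m) i)) (ℤP.pos-* m ∣ i ∣)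

+∣+m*i∣-nonneg : ∀ m {i} k → i ≡ + k → + ∣ + m ℤ.* i ∣ ≡ + m ℤ.* i
+∣+m*i∣-nonneg m k refl = +∣+m*i∣ m (+ k)

+∣+m*i∣-nonpos : ∀ m {i} k → i ≡ ℤ.- + k → + ∣ + m ℤ.* i ∣ ≡ + m ℤ.* + k
+∣+m*i∣-nonpos m k refl = trans (+∣+m*i∣ m (ℤ.- + k)) (cong (λ z → + m ℤ.* + z) (ℤP.∣-i∣≡∣i∣ (+ k)))

-- About the mean t/p of the values, x deviates by k (x - l)/p and l by a (l - x)/p.
energy-twoValued : ∀ a k x l d {t} → a ℕ.+ k ≡ suc d → t ≡ + a ℤ.* x ℤ.+ + k ℤ.* l →
  energy (replicate a x ++ replicate k l) t (suc d) ≡ (+ 2 ℤ.* + a ℤ.* + k ℤ.* + ∣ x ℤ.- l ∣) /ₙ suc d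
energy-twoValued a k x l d {t} a+k≡p t≡ = trans (energy≡Σdeviation/ₙ (replicate a x ++ replicate k l) t d) (cong (_/ₙ suc d) (begin
  Σdeviation (replicate a x ++ replicate k l) t p                ≡⟨ Σdeviation-++ (replicate a x) (replicate k l) t p ⟩
  Σdeviation (replicate a x) t p ℤ.+ Σdeviation (replicate k l) t p
                                                                 ≡⟨ cong₂ ℤ._+_ (Σdeviation-replicate a x t p) (Σdeviation-replicate k l t p) ⟩
  + a ℤ.* deviation t p x ℤ.+ + k ℤ.* deviation t p l            ≡⟨ cong₂ (λ u v → + a ℤ.* u ℤ.+ + k ℤ.* v) deviation-x deviation-l ⟩
  + a ℤ.* (+ k ℤ.* D) ℤ.+ + k ℤ.* (+ a ℤ.* D)                    ≡⟨ total (+ a) (+ k) D ⟩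
  + 2 ℤ.* + a ℤ.* + k ℤ.* D                                      ∎))
  where
  open ≡-Reasoning
  p = suc d
  D = + ∣ x ℤ.- l ∣
  p≡ : + p ≡ + a ℤ.+ + k
  p≡ = cong +_ (sym a+k≡p)
  deviation-x : deviation t p x ≡ + k ℤ.* D
  deviation-x = trans (cong (λ z → + ∣ z ∣) (trans (cong₂ (λ q s → x ℤ.* q ℤ.- s) p≡ t≡) (identity (+ a) (+ k) x l)))
                        (+∣+m*i∣ k (x ℤ.- l))
    where
    identity : ∀ a k x l → x ℤ.* (a ℤ.+ k) ℤ.- (a ℤ.* x ℤ.+ k ℤ.* l) ≡ k ℤ.* (x ℤ.- l)
    identity = solve-∀
  deviation-l : deviation t p l ≡ + a ℤ.* D
  deviation-l = trans (cong (λ z → + ∣ z ∣) (trans (cong₂ (λ q s → l ℤ.* q ℤ.- s) p≡ t≡) (identity (+ a) (+ k) x l)))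
                        (trans (cong +_ (ℤP.∣-i∣≡∣i∣ (+ a ℤ.* (x ℤ.- l)))) (+∣+m*i∣ a (x ℤ.- l)))
    where
    identity : ∀ a k x l → l ℤ.* (a ℤ.+ k) ℤ.- (a ℤ.* x ℤ.+ k ℤ.* l) ≡ ℤ.- (a ℤ.* (x ℤ.- l))
    identity = solve-∀
  total : ∀ a k D → a ℤ.* (k ℤ.* D) ℤ.+ k ℤ.* (a ℤ.* D) ≡ + 2 ℤ.* a ℤ.* k ℤ.* D
  total = solve-∀

foldFin-cong : ∀ {A : Set} (_⊕_ : A → A → A) e n {f g : Fin n → A} → (∀ j → f j ≡ g j) →
               foldFin _⊕_ e n f ≡ foldFin _⊕_ e n g
foldFin-cong _⊕_ e zero    h = refl
foldFin-cong _⊕_ e (suc n) h = cong₂ _⊕_ (h zero) (foldFin-cong _⊕_ e n (λ j → h (suc j)))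

ΣℕFin-cong : ∀ n {f g : Fin n → ℕ} → (∀ j → f j ≡ g j) → ΣℕFin n f ≡ ΣℕFin n g
ΣℕFin-cong = foldFin-cong ℕ._+_ 0

ΣℤFin-cong : ∀ n {f g : Fin n → ℤ} → (∀ j → f j ≡ g j) → ΣℤFin n f ≡ ΣℤFin n g
ΣℤFin-cong = foldFin-cong ℤ._+_ (+ 0)

ΣℕFin-++ : ∀ a b (f : Fin (a ℕ.+ b) → ℕ) → ΣℕFin (a ℕ.+ b) f ≡ ΣℕFin a (λ j → f (j ↑ˡ b)) ℕ.+ ΣℕFin b (λ c → f (a ↑ʳ c))
ΣℕFin-++ zero    b f = refl
ΣℕFin-++ (suc a) b f = trans (cong (f zero ℕ.+_) (ΣℕFin-++ a b (λ j → f (suc j)))) (sym (ℕP.+-assoc (f zero) _ _))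

ΣℤFin-++ : ∀ a b (f : Fin (a ℕ.+ b) → ℤ) → ΣℤFin (a ℕ.+ b) f ≡ ΣℤFin a (λ j → f (j ↑ˡ b)) ℤ.+ ΣℤFin b (λ c → f (a ↑ʳ c))
ΣℤFin-++ zero    b f = sym (ℤP.+-identityˡ _)
ΣℤFin-++ (suc a) b f = trans (cong (λ z → f zero ℤ.+ z) (ΣℤFin-++ a b (λ j → f (suc j)))) (sym (ℤP.+-assoc (f zero) _ _))

ΣℕFin-+ : ∀ n (f g : Fin n → ℕ) → ΣℕFin n (λ v → f v ℕ.+ g v) ≡ ΣℕFin n f ℕ.+ ΣℕFin n g
ΣℕFin-+ zero    f g = refl
ΣℕFin-+ (suc n) f g = trans (cong (f zero ℕ.+ g zero ℕ.+_) (ΣℕFin-+ n (λ j → f (suc j)) (λ j → g (suc j))))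
                            (ℕ-interchange (f zero) (g zero) _ _)

ΣℕFin-const : ∀ n c → ΣℕFin n (λ _ → c) ≡ n ℕ.* c
ΣℕFin-const zero    c = refl
ΣℕFin-const (suc n) c = cong (c ℕ.+_) (ΣℕFin-const n c)

ΣℤFin-const : ∀ n c → ΣℤFin n (λ _ → c) ≡ + n ℤ.* c
ΣℤFin-const zero    c = sym (ℤP.*-zeroˡ c)
ΣℤFin-const (suc n) c = trans (cong (λ z → c ℤ.+ z) (ΣℤFin-const n c)) (identity c (+ n))
  where
  identity : ∀ c n → c ℤ.+ n ℤ.* c ≡ (+ 1 ℤ.+ n) ℤ.* c
  identity = solve-∀

ΣℤFin-offDiagonal : ∀ {p} (i : Fin p) c → ΣℤFin p (λ j → if eq? i j then + 0 else c) ≡ + ℕ.pred p ℤ.* c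
ΣℤFin-offDiagonal {suc q}       zero    c = trans (ℤP.+-identityˡ _) (ΣℤFin-const q c)
ΣℤFin-offDiagonal {suc (suc q)} (suc i) c = begin
  c ℤ.+ ΣℤFin (suc q) (λ j → if eq? (suc i) (suc j) then + 0 else c)
    ≡⟨ cong (λ z → c ℤ.+ z) (ΣℤFin-cong (suc q) (λ j → cong (λ b → if b then + 0 else c) (eq?-suc i j))) ⟩
  c ℤ.+ ΣℤFin (suc q) (λ j → if eq? i j then + 0 else c)              ≡⟨ cong (λ z → c ℤ.+ z) (ΣℤFin-offDiagonal i c) ⟩
  c ℤ.+ + q ℤ.* c                                                     ≡⟨ identity c (+ q) ⟩
  + suc q ℤ.* c                                                       ∎
  where
  open ≡-Reasoning
  identity : ∀ c q → c ℤ.+ q ℤ.* c ≡ (+ 1 ℤ.+ q) ℤ.* c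
  identity = solve-∀

indicator : Bool → ℕ
indicator b = if b then 1 else 0

ΣℕFin-indicator-eq? : ∀ n (i : Fin n) → ΣℕFin n (λ v → indicator (eq? i v)) ≡ 1
ΣℕFin-indicator-eq? (suc n) zero    = cong suc (trans (ΣℕFin-const n 0) (ℕP.*-zeroʳ n))
ΣℕFin-indicator-eq? (suc n) (suc i) = trans (ΣℕFin-cong n (λ j → cong indicator (eq?-suc i j))) (ΣℕFin-indicator-eq? n i)

data Side (a b : ℕ) : Fin (a ℕ.+ b) → Set where
  left  : ∀ x → Side a b (x ↑ˡ b)
  right : ∀ y → Side a b (a ↑ʳ y)

side : ∀ a b (i : Fin (a ℕ.+ b)) → Side a b i
side a b i with splitAt a i in eq
... | inj₁ x = subst (Side a b) (FinP.splitAt⁻¹-↑ˡ eq) (left x)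
... | inj₂ y = subst (Side a b) (FinP.splitAt⁻¹-↑ʳ eq) (right y)

module _ {a b : ℕ} (G : Graph a) (H : Graph b) where

  join-↑ˡ-↑ˡ : ∀ x y → join G H (x ↑ˡ b) (y ↑ˡ b) ≡ G x y
  join-↑ˡ-↑ˡ x y rewrite FinP.splitAt-↑ˡ a x b | FinP.splitAt-↑ˡ a y b = refl

  join-↑ʳ-↑ʳ : ∀ x y → join G H (a ↑ʳ x) (a ↑ʳ y) ≡ H x y
  join-↑ʳ-↑ʳ x y rewrite FinP.splitAt-↑ʳ a b x | FinP.splitAt-↑ʳ a b y = refl

  join-↑ˡ-↑ʳ : ∀ x y → join G H (x ↑ˡ b) (a ↑ʳ y) ≡ true
  join-↑ˡ-↑ʳ x y rewrite FinP.splitAt-↑ˡ a x b | FinP.splitAt-↑ʳ a b y = refl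

  join-↑ʳ-↑ˡ : ∀ x y → join G H (a ↑ʳ x) (y ↑ˡ b) ≡ true
  join-↑ʳ-↑ˡ x y rewrite FinP.splitAt-↑ʳ a b x | FinP.splitAt-↑ˡ a y b = refl

IsComplete : ∀ {p} → Graph p → Set
IsComplete G = ∀ i j → G i j ≡ not (eq? i j)

join-K-complete : ∀ a {b} (H : Graph b) → IsComplete H → IsComplete (join (K a) H)
join-K-complete a {b} H H-complete i j with side a b i | side a b j
... | left x  | left y  = trans (join-↑ˡ-↑ˡ (K a) H x y) (cong not (sym (eq?-↑ˡ b x y)))
... | left x  | right y = trans (join-↑ˡ-↑ʳ (K a) H x y) (cong not (sym (eq?-↑ˡ-↑ʳ x y)))
... | right x | left y  = trans (join-↑ʳ-↑ˡ (K a) H x y) (cong not (sym (eq?-↑ʳ-↑ˡ y x)))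
... | right x | right y = trans (join-↑ʳ-↑ʳ (K a) H x y) (trans (H-complete x y) (cong not (sym (eq?-↑ʳ a x y))))

joinK-complete : ∀ ns → IsComplete (joinK ns)
joinK-complete []       ()
joinK-complete (n ∷ ns) = join-K-complete n (joinK ns) (joinK-complete ns)

Kbar-edgeless : ∀ m (x y : Fin m) → Kbar m x y ≡ false
Kbar-edgeless m x y with eq? x y
... | true  = refl
... | false = refl

if-eq?-cong : ∀ {A : Set} {n} (i j : Fin n) {x x' y y' : A} → (i ≡ j → x ≡ x') → (i ≢ j → y ≡ y') →
              (if eq? i j then x else y) ≡ (if eq? i j then x' else y')
if-eq?-cong i j x≡ y≡ with i FinP.≟ j
... | yes i≡j = x≡ i≡j
... | no i≢j  = y≡ i≢j

CNL-entry : ∀ {p} (G : Graph p) i j → CNL G i j ≡ (if eq? i j then CNrowsum G i else ℤ.- + commonNb G i j)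
CNL-entry G i j with eq? i j
... | true  = ℤP.+-identityʳ (CNrowsum G i)
... | false = ℤP.+-identityˡ _

CNSL-entry : ∀ {p} (G : Graph p) i j → CNSL G i j ≡ (if eq? i j then CNrowsum G i else + commonNb G i j)
CNSL-entry G i j with eq? i j
... | true  = ℤP.+-identityʳ (CNrowsum G i)
... | false = ℤP.+-identityˡ _

trace-CNRS : ∀ {p} (G : Graph p) → trace (CNRS G) ≡ ΣℤFin p (CNrowsum G)
trace-CNRS {p} G = ΣℤFin-cong p (λ i → cong (λ b → if b then CNrowsum G i else + 0) (eq?-refl i))

module CommonNbUniform {q} (G : Graph (suc q)) (c : ℤ) (commonNb≡c : ∀ i j → i ≢ j → + commonNb G i j ≡ c) where

  CNrowsum≡ : ∀ i → CNrowsum G i ≡ + q ℤ.* c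
  CNrowsum≡ i = trans (ΣℤFin-cong (suc q) (λ j → if-eq?-cong i j {x = + 0} (λ _ → refl) (commonNb≡c i j)))
                      (ΣℤFin-offDiagonal i c)

  CNL≡ : ∀ i j → CNL G i j ≡ (if eq? i j then + q ℤ.* c else ℤ.- c)
  CNL≡ i j = trans (CNL-entry G i j) (if-eq?-cong i j (λ _ → CNrowsum≡ i) (cong ℤ.-_ ∘ commonNb≡c i j))

  CNSL≡ : ∀ i j → CNSL G i j ≡ (if eq? i j then + q ℤ.* c else c)
  CNSL≡ i j = trans (CNSL-entry G i j) (if-eq?-cong i j (λ _ → CNrowsum≡ i) (commonNb≡c i j))

  trace-CNRS≡ : trace (CNRS G) ≡ + suc q ℤ.* (+ q ℤ.* c)
  trace-CNRS≡ = trans (trace-CNRS G) (trans (ΣℤFin-cong (suc q) CNrowsum≡) (ΣℤFin-const (suc q) _))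

-- Every vertex other than i and j is a common neighbour of i and j.
complete-commonNb : ∀ {p} (G : Graph p) → IsComplete G → ∀ i j → i ≢ j → commonNb G i j ℕ.+ 2 ≡ p
complete-commonNb {p} G G-complete i j i≢j = begin
  commonNb G i j ℕ.+ 2
    ≡⟨ cong₂ ℕ._+_ (ΣℕFin-cong p (λ v → cong₂ (λ x y → indicator (x ∧ y)) (G-complete i v) (G-complete j v)))
                   (sym (cong₂ ℕ._+_ (ΣℕFin-indicator-eq? p i) (ΣℕFin-indicator-eq? p j))) ⟩
  ΣℕFin p other ℕ.+ (ΣℕFin p (λ v → indicator (eq? i v)) ℕ.+ ΣℕFin p (λ v → indicator (eq? j v)))
    ≡⟨ cong (ΣℕFin p other ℕ.+_) (ΣℕFin-+ p _ _) ⟨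
  ΣℕFin p other ℕ.+ ΣℕFin p (λ v → indicator (eq? i v) ℕ.+ indicator (eq? j v))
    ≡⟨ ΣℕFin-+ p other _ ⟨
  ΣℕFin p (λ v → other v ℕ.+ (indicator (eq? i v) ℕ.+ indicator (eq? j v)))
    ≡⟨ ΣℕFin-cong p (λ v → partition (eq? i v) (eq? j v) (λ i≡v j≡v → i≢j (trans (eq?⇒≡ i≡v) (sym (eq?⇒≡ j≡v))))) ⟩
  ΣℕFin p (λ _ → 1)
    ≡⟨ ΣℕFin-const p 1 ⟩
  p ℕ.* 1
    ≡⟨ ℕP.*-identityʳ p ⟩
  p ∎
  where
  open ≡-Reasoning
  other : Fin p → ℕ
  other v = indicator (not (eq? i v) ∧ not (eq? j v))
  partition : ∀ a b → (a ≡ true → b ≡ true → ⊥) → indicator (not a ∧ not b) ℕ.+ (indicator a ℕ.+ indicator b) ≡ 1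
  partition true  true  both = ⊥-elim (both refl refl)
  partition true  false _    = refl
  partition false true  _    = refl
  partition false false _    = refl
  eq?⇒≡ : ∀ {u v : Fin p} → eq? u v ≡ true → u ≡ v
  eq?⇒≡ {u} {v} e with u FinP.≟ v
  ... | yes u≡v = u≡v

module CompleteBipartiteCN (m n : ℕ) where

  G : Graph (m ℕ.+ n)
  G = join (Kbar m) (Kbar n)

  commonNb-split : ∀ i j a b → (∀ v → G i (v ↑ˡ n) ∧ G j (v ↑ˡ n) ≡ a) → (∀ v → G i (m ↑ʳ v) ∧ G j (m ↑ʳ v) ≡ b) →
                   commonNb G i j ≡ m ℕ.* indicator a ℕ.+ n ℕ.* indicator b
  commonNb-split i j a b on-left on-right = trans (ΣℕFin-++ m n _) (cong₂ ℕ._+_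
    (trans (ΣℕFin-cong m (cong indicator ∘ on-left)) (ΣℕFin-const m _))
    (trans (ΣℕFin-cong n (cong indicator ∘ on-right)) (ΣℕFin-const n _)))

  G-↑ˡ-↑ˡ : ∀ x y → G (x ↑ˡ n) (y ↑ˡ n) ≡ false
  G-↑ˡ-↑ˡ x y = trans (join-↑ˡ-↑ˡ (Kbar m) (Kbar n) x y) (Kbar-edgeless m x y)

  G-↑ʳ-↑ʳ : ∀ x y → G (m ↑ʳ x) (m ↑ʳ y) ≡ false
  G-↑ʳ-↑ʳ x y = trans (join-↑ʳ-↑ʳ (Kbar m) (Kbar n) x y) (Kbar-edgeless n x y)

  commonNb-↑ˡ-↑ˡ : ∀ x y → commonNb G (x ↑ˡ n) (y ↑ˡ n) ≡ n
  commonNb-↑ˡ-↑ˡ x y = trans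
    (commonNb-split _ _ false true (λ v → cong₂ _∧_ (G-↑ˡ-↑ˡ x v) (G-↑ˡ-↑ˡ y v))
                                   (λ v → cong₂ _∧_ (join-↑ˡ-↑ʳ (Kbar m) (Kbar n) x v) (join-↑ˡ-↑ʳ (Kbar m) (Kbar n) y v)))
    (cong₂ ℕ._+_ (ℕP.*-zeroʳ m) (ℕP.*-identityʳ n))

  commonNb-↑ʳ-↑ʳ : ∀ x y → commonNb G (m ↑ʳ x) (m ↑ʳ y) ≡ m
  commonNb-↑ʳ-↑ʳ x y = trans
    (commonNb-split _ _ true false (λ v → cong₂ _∧_ (join-↑ʳ-↑ˡ (Kbar m) (Kbar n) x v) (join-↑ʳ-↑ˡ (Kbar m) (Kbar n) y v))
                                   (λ v → cong₂ _∧_ (G-↑ʳ-↑ʳ x v) (G-↑ʳ-↑ʳ y v)))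
    (trans (cong₂ ℕ._+_ (ℕP.*-identityʳ m) (ℕP.*-zeroʳ n)) (ℕP.+-identityʳ m))

  commonNb-↑ˡ-↑ʳ : ∀ x y → commonNb G (x ↑ˡ n) (m ↑ʳ y) ≡ 0
  commonNb-↑ˡ-↑ʳ x y = trans
    (commonNb-split _ _ false false (λ v → cong₂ _∧_ (G-↑ˡ-↑ˡ x v) (join-↑ʳ-↑ˡ (Kbar m) (Kbar n) y v))
                                    (λ v → cong₂ _∧_ (join-↑ˡ-↑ʳ (Kbar m) (Kbar n) x v) (G-↑ʳ-↑ʳ y v)))
    (cong₂ ℕ._+_ (ℕP.*-zeroʳ m) (ℕP.*-zeroʳ n))

  commonNb-↑ʳ-↑ˡ : ∀ x y → commonNb G (m ↑ʳ x) (y ↑ˡ n) ≡ 0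
  commonNb-↑ʳ-↑ˡ x y = trans
    (commonNb-split _ _ false false (λ v → cong₂ _∧_ (join-↑ʳ-↑ˡ (Kbar m) (Kbar n) x v) (G-↑ˡ-↑ˡ y v))
                                    (λ v → cong₂ _∧_ (G-↑ʳ-↑ʳ x v) (join-↑ˡ-↑ʳ (Kbar m) (Kbar n) y v)))
    (cong₂ ℕ._+_ (ℕP.*-zeroʳ m) (ℕP.*-zeroʳ n))

  CNrowsum-↑ˡ : ∀ x → CNrowsum G (x ↑ˡ n) ≡ + ℕ.pred m ℤ.* + n
  CNrowsum-↑ˡ x = begin
    CNrowsum G (x ↑ˡ n)                                                 ≡⟨ ΣℤFin-++ m n _ ⟩
    ΣℤFin m (λ y → CN G (x ↑ˡ n) (y ↑ˡ n)) ℤ.+ ΣℤFin n (λ y → CN G (x ↑ˡ n) (m ↑ʳ y))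
                                                                        ≡⟨ cong₂ ℤ._+_ (ΣℤFin-cong m on-left) (ΣℤFin-cong n on-right) ⟩
    ΣℤFin m (λ y → if eq? x y then + 0 else + n) ℤ.+ ΣℤFin n (λ _ → + 0)
                                                                        ≡⟨ cong₂ ℤ._+_ (ΣℤFin-offDiagonal x (+ n)) (ΣℤFin-const n (+ 0)) ⟩
    + ℕ.pred m ℤ.* + n ℤ.+ + n ℤ.* + 0                                  ≡⟨ cong (λ z → + ℕ.pred m ℤ.* + n ℤ.+ z) (ℤP.*-zeroʳ (+ n)) ⟩
    + ℕ.pred m ℤ.* + n ℤ.+ + 0                                          ≡⟨ ℤP.+-identityʳ _ ⟩
    + ℕ.pred m ℤ.* + n                                                  ∎
    where
    open ≡-Reasoning
    on-left : ∀ y → CN G (x ↑ˡ n) (y ↑ˡ n) ≡ (if eq? x y then + 0 else + n)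
    on-left y = trans (cong (λ b → if b then + 0 else + commonNb G (x ↑ˡ n) (y ↑ˡ n)) (eq?-↑ˡ n x y))
                   (if-eq?-cong x y (λ _ → refl) (λ _ → cong +_ (commonNb-↑ˡ-↑ˡ x y)))
    on-right : ∀ y → CN G (x ↑ˡ n) (m ↑ʳ y) ≡ + 0
    on-right y = trans (cong (λ b → if b then + 0 else + commonNb G (x ↑ˡ n) (m ↑ʳ y)) (eq?-↑ˡ-↑ʳ x y))
                    (cong +_ (commonNb-↑ˡ-↑ʳ x y))

  CNrowsum-↑ʳ : ∀ y → CNrowsum G (m ↑ʳ y) ≡ + ℕ.pred n ℤ.* + m
  CNrowsum-↑ʳ y = begin
    CNrowsum G (m ↑ʳ y)                                                 ≡⟨ ΣℤFin-++ m n _ ⟩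
    ΣℤFin m (λ x → CN G (m ↑ʳ y) (x ↑ˡ n)) ℤ.+ ΣℤFin n (λ x → CN G (m ↑ʳ y) (m ↑ʳ x))
                                                                        ≡⟨ cong₂ ℤ._+_ (ΣℤFin-cong m on-left) (ΣℤFin-cong n on-right) ⟩
    ΣℤFin m (λ _ → + 0) ℤ.+ ΣℤFin n (λ x → if eq? y x then + 0 else + m)
                                                                        ≡⟨ cong₂ ℤ._+_ (ΣℤFin-const m (+ 0)) (ΣℤFin-offDiagonal y (+ m)) ⟩
    + m ℤ.* + 0 ℤ.+ + ℕ.pred n ℤ.* + m                                  ≡⟨ cong (ℤ._+ + ℕ.pred n ℤ.* + m) (ℤP.*-zeroʳ (+ m)) ⟩
    + 0 ℤ.+ + ℕ.pred n ℤ.* + m                                          ≡⟨ ℤP.+-identityˡ _ ⟩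
    + ℕ.pred n ℤ.* + m                                                  ∎
    where
    open ≡-Reasoning
    on-left : ∀ x → CN G (m ↑ʳ y) (x ↑ˡ n) ≡ + 0
    on-left x = trans (cong (λ b → if b then + 0 else + commonNb G (m ↑ʳ y) (x ↑ˡ n)) (eq?-↑ʳ-↑ˡ x y))
                   (cong +_ (commonNb-↑ʳ-↑ˡ y x))
    on-right : ∀ x → CN G (m ↑ʳ y) (m ↑ʳ x) ≡ (if eq? y x then + 0 else + m)
    on-right x = trans (cong (λ b → if b then + 0 else + commonNb G (m ↑ʳ y) (m ↑ʳ x)) (eq?-↑ʳ m y x))
                    (if-eq?-cong y x (λ _ → refl) (λ _ → cong +_ (commonNb-↑ʳ-↑ʳ y x)))

  CNL-↑ˡ-↑ˡ : ∀ x y → CNL G (x ↑ˡ n) (y ↑ˡ n) ≡ (if eq? x y then + ℕ.pred m ℤ.* + n else ℤ.- + n)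
  CNL-↑ˡ-↑ˡ x y = trans (CNL-entry G (x ↑ˡ n) (y ↑ˡ n)) (trans
    (cong (λ b → if b then CNrowsum G (x ↑ˡ n) else ℤ.- + commonNb G (x ↑ˡ n) (y ↑ˡ n)) (eq?-↑ˡ n x y))
    (if-eq?-cong x y (λ _ → CNrowsum-↑ˡ x) (λ _ → cong (λ k → ℤ.- + k) (commonNb-↑ˡ-↑ˡ x y))))

  CNL-↑ʳ-↑ʳ : ∀ x y → CNL G (m ↑ʳ x) (m ↑ʳ y) ≡ (if eq? x y then + ℕ.pred n ℤ.* + m else ℤ.- + m)
  CNL-↑ʳ-↑ʳ x y = trans (CNL-entry G (m ↑ʳ x) (m ↑ʳ y)) (trans
    (cong (λ b → if b then CNrowsum G (m ↑ʳ x) else ℤ.- + commonNb G (m ↑ʳ x) (m ↑ʳ y)) (eq?-↑ʳ m x y))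
    (if-eq?-cong x y (λ _ → CNrowsum-↑ʳ x) (λ _ → cong (λ k → ℤ.- + k) (commonNb-↑ʳ-↑ʳ x y))))

  CNL-↑ˡ-↑ʳ : ∀ x y → CNL G (x ↑ˡ n) (m ↑ʳ y) ≡ + 0
  CNL-↑ˡ-↑ʳ x y = trans (CNL-entry G (x ↑ˡ n) (m ↑ʳ y)) (trans
    (cong (λ b → if b then CNrowsum G (x ↑ˡ n) else ℤ.- + commonNb G (x ↑ˡ n) (m ↑ʳ y)) (eq?-↑ˡ-↑ʳ x y))
    (cong (λ k → ℤ.- + k) (commonNb-↑ˡ-↑ʳ x y)))

  CNSL-↑ˡ-↑ˡ : ∀ x y → CNSL G (x ↑ˡ n) (y ↑ˡ n) ≡ (if eq? x y then + ℕ.pred m ℤ.* + n else + n)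
  CNSL-↑ˡ-↑ˡ x y = trans (CNSL-entry G (x ↑ˡ n) (y ↑ˡ n)) (trans
    (cong (λ b → if b then CNrowsum G (x ↑ˡ n) else + commonNb G (x ↑ˡ n) (y ↑ˡ n)) (eq?-↑ˡ n x y))
    (if-eq?-cong x y (λ _ → CNrowsum-↑ˡ x) (λ _ → cong +_ (commonNb-↑ˡ-↑ˡ x y))))

  CNSL-↑ʳ-↑ʳ : ∀ x y → CNSL G (m ↑ʳ x) (m ↑ʳ y) ≡ (if eq? x y then + ℕ.pred n ℤ.* + m else + m)
  CNSL-↑ʳ-↑ʳ x y = trans (CNSL-entry G (m ↑ʳ x) (m ↑ʳ y)) (trans
    (cong (λ b → if b then CNrowsum G (m ↑ʳ x) else + commonNb G (m ↑ʳ x) (m ↑ʳ y)) (eq?-↑ʳ m x y))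
    (if-eq?-cong x y (λ _ → CNrowsum-↑ʳ x) (λ _ → cong +_ (commonNb-↑ʳ-↑ʳ x y))))

  CNSL-↑ˡ-↑ʳ : ∀ x y → CNSL G (x ↑ˡ n) (m ↑ʳ y) ≡ + 0
  CNSL-↑ˡ-↑ʳ x y = trans (CNSL-entry G (x ↑ˡ n) (m ↑ʳ y)) (trans
    (cong (λ b → if b then CNrowsum G (x ↑ˡ n) else + commonNb G (x ↑ˡ n) (m ↑ʳ y)) (eq?-↑ˡ-↑ʳ x y))
    (cong +_ (commonNb-↑ˡ-↑ʳ x y)))

  trace-CNRS≡ : trace (CNRS G) ≡ + m ℤ.* (+ ℕ.pred m ℤ.* + n) ℤ.+ + n ℤ.* (+ ℕ.pred n ℤ.* + m)
  trace-CNRS≡ = trans (trace-CNRS G) (trans (ΣℤFin-++ m n _) (cong₂ ℤ._+_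
    (trans (ΣℤFin-cong m CNrowsum-↑ˡ) (ΣℤFin-const m _))
    (trans (ΣℤFin-cong n CNrowsum-↑ʳ) (ΣℤFin-const n _))))

module CompleteSpectra {q} (G : Graph (suc q)) (G-complete : IsComplete G) where

  N : ℤ
  N = + suc q

  commonNb≡ : ∀ i j → i ≢ j → + commonNb G i j ≡ N ℤ.- + 2
  commonNb≡ i j i≢j = trans (identity (+ commonNb G i j)) (cong (λ k → + k ℤ.- + 2) (complete-commonNb G G-complete i j i≢j))
    where
    identity : ∀ k → k ≡ k ℤ.+ + 2 ℤ.- + 2
    identity = solve-∀

  open CommonNbUniform G (N ℤ.- + 2) commonNb≡

  spectrum-CNL : charPoly (CNL G) ≈ prodLin (+ 0 ∷ replicate q (N ℤ.* (N ℤ.- + 2)))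
  spectrum-CNL = charPoly-uniform q (CNL G) _ _ CNL≡ (x≡ (+ q)) (l≡ (+ q))
    where
    x≡ : ∀ q → let N = + 1 ℤ.+ q in
      + 0 ≡ q ℤ.* (N ℤ.- + 2) ℤ.+ q ℤ.* ℤ.- (N ℤ.- + 2)
    x≡ = solve-∀
    l≡ : ∀ q → let N = + 1 ℤ.+ q in
      N ℤ.* (N ℤ.- + 2) ≡ q ℤ.* (N ℤ.- + 2) ℤ.- ℤ.- (N ℤ.- + 2)
    l≡ = solve-∀

  spectrum-CNSL : charPoly (CNSL G) ≈ prodLin ((+ 2 ℤ.* (N ℤ.- + 1) ℤ.* (N ℤ.- + 2)) ∷ replicate q ((N ℤ.- + 2) ℤ.* (N ℤ.- + 2)))
  spectrum-CNSL = charPoly-uniform q (CNSL G) _ _ CNSL≡ (x≡ (+ q)) (l≡ (+ q))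
    where
    x≡ : ∀ q → let N = + 1 ℤ.+ q in
      + 2 ℤ.* (N ℤ.- + 1) ℤ.* (N ℤ.- + 2) ≡ q ℤ.* (N ℤ.- + 2) ℤ.+ q ℤ.* (N ℤ.- + 2)
    x≡ = solve-∀
    l≡ : ∀ q → let N = + 1 ℤ.+ q in
      (N ℤ.- + 2) ℤ.* (N ℤ.- + 2) ≡ q ℤ.* (N ℤ.- + 2) ℤ.- (N ℤ.- + 2)
    l≡ = solve-∀

  -- The two eigenvalues always differ by ± N (N - 2), which is nonnegative unless q = 0.
  energy-twoValued-complete : ∀ x l {t} → t ≡ + 1 ℤ.* x ℤ.+ + q ℤ.* l → + ∣ x ℤ.- l ∣ ≡ + ∣ N ℤ.* (N ℤ.- + 2) ∣ →
    energy (x ∷ replicate q l) t (suc q) ≡ (+ 2 ℤ.* (N ℤ.- + 1) ℤ.* (N ℤ.- + 2)) /ₙ 1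
  energy-twoValued-complete x l t≡ gap≡ = trans (energy-twoValued 1 q x l q refl t≡)
    (/ₙ-≡ (+ 2 ℤ.* + 1 ℤ.* + q ℤ.* + ∣ x ℤ.- l ∣) (+ 2 ℤ.* (N ℤ.- + 1) ℤ.* (N ℤ.- + 2)) q 0
          (trans (cong (λ g → + 2 ℤ.* + 1 ℤ.* + q ℤ.* g ℤ.* + 1) gap≡) (cross q)))
    where
    cross : ∀ q → + 2 ℤ.* + 1 ℤ.* + q ℤ.* + ∣ + suc q ℤ.* (+ suc q ℤ.- + 2) ∣ ℤ.* + 1
                ≡ + 2 ℤ.* (+ suc q ℤ.- + 1) ℤ.* (+ suc q ℤ.- + 2) ℤ.* + suc q
    cross zero    = identity (+ ∣ + 1 ℤ.* (+ 1 ℤ.- + 2) ∣)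
      where
      identity : ∀ g → + 2 ℤ.* + 1 ℤ.* + 0 ℤ.* g ℤ.* + 1 ≡ + 2 ℤ.* (+ 1 ℤ.- + 1) ℤ.* (+ 1 ℤ.- + 2) ℤ.* + 1
      identity = solve-∀
    cross (suc r) = begin
      + 2 ℤ.* + 1 ℤ.* + suc r ℤ.* + ∣ + suc (suc r) ℤ.* (+ suc (suc r) ℤ.- + 2) ∣ ℤ.* + 1
        ≡⟨ cong (λ z → + 2 ℤ.* + 1 ℤ.* + suc r ℤ.* + ∣ + suc (suc r) ℤ.* z ∣ ℤ.* + 1) (minus2 (+ r)) ⟩
      + 2 ℤ.* + 1 ℤ.* + suc r ℤ.* + ∣ + suc (suc r) ℤ.* + r ∣ ℤ.* + 1
        ≡⟨ cong (λ z → + 2 ℤ.* + 1 ℤ.* + suc r ℤ.* z ℤ.* + 1) (+∣+m*i∣ (suc (suc r)) (+ r)) ⟩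
      + 2 ℤ.* + 1 ℤ.* + suc r ℤ.* (+ suc (suc r) ℤ.* + r) ℤ.* + 1
        ≡⟨ identity (+ r) ⟩
      + 2 ℤ.* (+ suc (suc r) ℤ.- + 1) ℤ.* (+ suc (suc r) ℤ.- + 2) ℤ.* + suc (suc r) ∎
      where
      open ≡-Reasoning
      minus2 : ∀ r → (+ 2 ℤ.+ r) ℤ.- + 2 ≡ r
      minus2 = solve-∀
      identity : ∀ r → + 2 ℤ.* + 1 ℤ.* (+ 1 ℤ.+ r) ℤ.* ((+ 2 ℤ.+ r) ℤ.* r) ℤ.* + 1
                     ≡ + 2 ℤ.* ((+ 2 ℤ.+ r) ℤ.- + 1) ℤ.* ((+ 2 ℤ.+ r) ℤ.- + 2) ℤ.* (+ 2 ℤ.+ r)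
      identity = solve-∀

  trace≡ : ∀ x l → x ℤ.+ + q ℤ.* l ≡ N ℤ.* (+ q ℤ.* (N ℤ.- + 2)) → trace (CNRS G) ≡ + 1 ℤ.* x ℤ.+ + q ℤ.* l
  trace≡ x l sum≡ = trans trace-CNRS≡ (trans (sym sum≡) (cong (ℤ._+ + q ℤ.* l) (sym (ℤP.*-identityˡ x))))

  energy-CNL : LECN-is G ((+ 2 ℤ.* (N ℤ.- + 1) ℤ.* (N ℤ.- + 2)) /ₙ 1)
  energy-CNL = energy-ofSpectrum (CNL G) (x ∷ replicate q l) (trace (CNRS G)) spectrum-CNL
    (energy-twoValued-complete x l (trace≡ x l (sum≡ (+ q)))
      (trans (cong (λ z → + ∣ z ∣) (ℤP.+-identityˡ (ℤ.- l))) (cong +_ (ℤP.∣-i∣≡∣i∣ l))))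
    where
    x l : ℤ
    x = + 0
    l = N ℤ.* (N ℤ.- + 2)
    sum≡ : ∀ q → let N = + 1 ℤ.+ q in
      + 0 ℤ.+ q ℤ.* (N ℤ.* (N ℤ.- + 2)) ≡ N ℤ.* (q ℤ.* (N ℤ.- + 2))
    sum≡ = solve-∀

  energy-CNSL : LECN⁺-is G ((+ 2 ℤ.* (N ℤ.- + 1) ℤ.* (N ℤ.- + 2)) /ₙ 1)
  energy-CNSL = energy-ofSpectrum (CNSL G) (x ∷ replicate q l) (trace (CNRS G)) spectrum-CNSL
    (energy-twoValued-complete x l (trace≡ x l (sum≡ (+ q))) (cong (λ z → + ∣ z ∣) (gap (+ q))))
    where
    x l : ℤ
    x = + 2 ℤ.* (N ℤ.- + 1) ℤ.* (N ℤ.- + 2)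
    l = (N ℤ.- + 2) ℤ.* (N ℤ.- + 2)
    sum≡ : ∀ q → let N = + 1 ℤ.+ q in
      + 2 ℤ.* (N ℤ.- + 1) ℤ.* (N ℤ.- + 2) ℤ.+ q ℤ.* ((N ℤ.- + 2) ℤ.* (N ℤ.- + 2)) ≡ N ℤ.* (q ℤ.* (N ℤ.- + 2))
    sum≡ = solve-∀
    gap : ∀ q → let N = + 1 ℤ.+ q in
      + 2 ℤ.* (N ℤ.- + 1) ℤ.* (N ℤ.- + 2) ℤ.- (N ℤ.- + 2) ℤ.* (N ℤ.- + 2) ≡ N ℤ.* (N ℤ.- + 2)
    gap = solve-∀

complete-CN-spectra : ∀ p (G : Graph p) → IsComplete G → 1 ≤ p →
    IsSpectrum (CNL G) (+ 0 ∷ replicate (p ∸ 1) (+ p ℤ.* (+ p ℤ.- + 2)))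
  × IsSpectrum (CNSL G) ((+ 2 ℤ.* (+ p ℤ.- + 1) ℤ.* (+ p ℤ.- + 2)) ∷ replicate (p ∸ 1) ((+ p ℤ.- + 2) ℤ.* (+ p ℤ.- + 2)))
  × LECN-is G ((+ 2 ℤ.* (+ p ℤ.- + 1) ℤ.* (+ p ℤ.- + 2)) /ₙ 1)
  × LECN⁺-is G ((+ 2 ℤ.* (+ p ℤ.- + 1) ℤ.* (+ p ℤ.- + 2)) /ₙ 1)
complete-CN-spectra (suc q) G G-complete _ =
  coeff-≡ spectrum-CNL , coeff-≡ spectrum-CNSL , energy-CNL , energy-CNSL
  where open CompleteSpectra G G-complete

replicate-++ : ∀ {A : Set} a b (x : A) → replicate a x ++ replicate b x ≡ replicate (a ℕ.+ b) x
replicate-++ zero    b x = refl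
replicate-++ (suc a) b x = cong (x ∷_) (replicate-++ a b x)

module CompleteBipartiteSpectra (m' n' : ℕ) where

  m n : ℕ
  m = suc m'
  n = suc n'

  open CompleteBipartiteCN m n public
    using (G; CNL-↑ˡ-↑ˡ; CNL-↑ʳ-↑ʳ; CNL-↑ˡ-↑ʳ; CNSL-↑ˡ-↑ˡ; CNSL-↑ʳ-↑ʳ; CNSL-↑ˡ-↑ʳ; trace-CNRS≡)

  m+n∸2≡ : m ℕ.+ n ∸ 2 ≡ m' ℕ.+ n'
  m+n∸2≡ = cong (_∸ 1) (ℕP.+-suc m' n')

  spectrum-CNL : charPoly (CNL G) ≈ prodLin (+ 0 ∷ + 0 ∷ replicate (m ℕ.+ n ∸ 2) (+ (m ℕ.* n)))
  spectrum-CNL = ≈-trans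
    (charPoly-blockUniform m' n' (CNL G) _ _ _ _ CNL-↑ˡ-↑ˡ CNL-↑ʳ-↑ʳ CNL-↑ˡ-↑ʳ
      (zero≡ (+ m') (+ n)) (trans (ℤP.pos-* m n) (mnA (+ m') (+ n)))
      (zero≡ (+ n') (+ m)) (trans (ℤP.pos-* m n) (mnB (+ m) (+ n'))))
    (prodLin-↭ (↭.prep (+ 0) (↭.trans (shift (+ 0) (replicate m' mn) (replicate n' mn))
      (↭.prep (+ 0) (↭-reflexive (trans (replicate-++ m' n' mn) (cong (λ k → replicate k mn) (sym m+n∸2≡))))))))
    where
    mn = + (m ℕ.* n)
    zero≡ : ∀ a b → + 0 ≡ a ℤ.* b ℤ.+ a ℤ.* ℤ.- b
    zero≡ = solve-∀
    mnA : ∀ a b → let m = + 1 ℤ.+ a in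
      m ℤ.* b ≡ a ℤ.* b ℤ.- ℤ.- b
    mnA = solve-∀
    mnB : ∀ a b → let n = + 1 ℤ.+ b in
      a ℤ.* n ≡ b ℤ.* a ℤ.- ℤ.- a
    mnB = solve-∀

  energy-CNL : LECN-is G ((+ 4 ℤ.* + m ℤ.* + n ℤ.* (+ m ℤ.+ + n ℤ.- + 2)) /ₙ (m ℕ.+ n))
  energy-CNL = energy-ofSpectrum (CNL G) (+ 0 ∷ + 0 ∷ replicate (m ℕ.+ n ∸ 2) (+ (m ℕ.* n))) (trace (CNRS G)) spectrum-CNL
    (trans (energy-twoValued 2 (m ℕ.+ n ∸ 2) (+ 0) (+ (m ℕ.* n)) (m' ℕ.+ n) size≡ trace≡) (cong (_/ₙ (m ℕ.+ n)) numerator≡))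
    where
    size≡ : 2 ℕ.+ (m ℕ.+ n ∸ 2) ≡ suc (m' ℕ.+ n)
    size≡ = trans (cong (2 ℕ.+_) m+n∸2≡) (cong suc (sym (ℕP.+-suc m' n')))
    mn≡ : + (m ℕ.* n) ≡ + m ℤ.* + n
    mn≡ = ℤP.pos-* m n
    trace≡ : trace (CNRS G) ≡ + 2 ℤ.* + 0 ℤ.+ + (m ℕ.+ n ∸ 2) ℤ.* + (m ℕ.* n)
    trace≡ = trans trace-CNRS≡ (trans (identity (+ m') (+ n'))
      (sym (cong₂ (λ k mn → + 2 ℤ.* + 0 ℤ.+ + k ℤ.* mn) m+n∸2≡ mn≡)))
      where
      identity : ∀ a b → let m = + 1 ℤ.+ a; n = + 1 ℤ.+ b in
        m ℤ.* (a ℤ.* n) ℤ.+ n ℤ.* (b ℤ.* m)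
          ≡ + 2 ℤ.* + 0 ℤ.+ (a ℤ.+ b) ℤ.* (m ℤ.* n)
      identity = solve-∀
    numerator≡ : + 2 ℤ.* + 2 ℤ.* + (m ℕ.+ n ∸ 2) ℤ.* + ∣ + 0 ℤ.- + (m ℕ.* n) ∣ ≡ + 4 ℤ.* + m ℤ.* + n ℤ.* (+ m ℤ.+ + n ℤ.- + 2)
    numerator≡ = trans (cong₂ (λ k g → + 2 ℤ.* + 2 ℤ.* + k ℤ.* g) m+n∸2≡
                              (trans (cong (λ z → + ∣ z ∣) (ℤP.+-identityˡ (ℤ.- + (m ℕ.* n)))) mn≡))
                       (identity (+ m') (+ n'))
      where
      identity : ∀ a b → let m = + 1 ℤ.+ a; n = + 1 ℤ.+ b in
        + 2 ℤ.* + 2 ℤ.* (a ℤ.+ b) ℤ.* (m ℤ.* n)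
          ≡ + 4 ℤ.* m ℤ.* n ℤ.* (m ℤ.+ n ℤ.- + 2)
      identity = solve-∀

  xA lA xB lB : ℤ
  xA = + 2 ℤ.* + n ℤ.* (+ m ℤ.- + 1)
  lA = + n ℤ.* (+ m ℤ.- + 2)
  xB = + 2 ℤ.* + m ℤ.* (+ n ℤ.- + 1)
  lB = + m ℤ.* (+ n ℤ.- + 2)

  spectrumCNSL : List ℤ
  spectrumCNSL = (xA ∷ replicate m' lA) ++ (xB ∷ replicate n' lB)

  spectrum-CNSL : charPoly (CNSL G) ≈ prodLin spectrumCNSL
  spectrum-CNSL = charPoly-blockUniform m' n' (CNSL G) _ _ _ _ CNSL-↑ˡ-↑ˡ CNSL-↑ʳ-↑ʳ CNSL-↑ˡ-↑ʳ
    (x≡ (+ m') (+ n)) (l≡ (+ m') (+ n)) (x≡ (+ n') (+ m)) (l≡ (+ n') (+ m))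
    where
    x≡ : ∀ a b → let m = + 1 ℤ.+ a in
      + 2 ℤ.* b ℤ.* (m ℤ.- + 1) ≡ a ℤ.* b ℤ.+ a ℤ.* b
    x≡ = solve-∀
    l≡ : ∀ a b → let m = + 1 ℤ.+ a in
      b ℤ.* (m ℤ.- + 2) ≡ a ℤ.* b ℤ.- b
    l≡ = solve-∀

  t : ℤ
  t = trace (CNRS G)

  xA-deviation : xA ℤ.* + (m ℕ.+ n) ℤ.- t ≡ + n ℤ.* (+ m ℤ.* + m ℤ.+ + n ℤ.* (+ m ℤ.- + 2))
  xA-deviation = trans (cong (λ s → xA ℤ.* + (m ℕ.+ n) ℤ.- s) trace-CNRS≡) (identity (+ m') (+ n'))
    where
    identity : ∀ a b → let m = + 1 ℤ.+ a; n = + 1 ℤ.+ b in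
      + 2 ℤ.* n ℤ.* (m ℤ.- + 1) ℤ.* (m ℤ.+ n)
        ℤ.- (m ℤ.* (a ℤ.* n) ℤ.+ n ℤ.* (b ℤ.* m))
        ≡ n ℤ.* (m ℤ.* m ℤ.+ n ℤ.* (m ℤ.- + 2))
    identity = solve-∀

  xB-deviation : xB ℤ.* + (m ℕ.+ n) ℤ.- t ≡ + m ℤ.* (+ n ℤ.* + n ℤ.+ + m ℤ.* (+ n ℤ.- + 2))
  xB-deviation = trans (cong (λ s → xB ℤ.* + (m ℕ.+ n) ℤ.- s) trace-CNRS≡) (identity (+ m') (+ n'))
    where
    identity : ∀ a b → let m = + 1 ℤ.+ a; n = + 1 ℤ.+ b in
      + 2 ℤ.* m ℤ.* (n ℤ.- + 1) ℤ.* (m ℤ.+ n)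
        ℤ.- (m ℤ.* (a ℤ.* n) ℤ.+ n ℤ.* (b ℤ.* m))
        ≡ m ℤ.* (n ℤ.* n ℤ.+ m ℤ.* (n ℤ.- + 2))
    identity = solve-∀

  lA-deviation : deviation t (m ℕ.+ n) lA ≡ + 2 ℤ.* (+ n ℤ.* + n)
  lA-deviation = trans (cong (λ z → + ∣ z ∣) (trans (cong (λ s → lA ℤ.* + (m ℕ.+ n) ℤ.- s) trace-CNRS≡) (identity (+ m') (+ n'))))
    (trans (cong +_ (ℤP.∣-i∣≡∣i∣ (+ 2 ℤ.* (+ n ℤ.* + n)))) (trans (+∣+m*i∣ 2 (+ n ℤ.* + n)) (cong (+ 2 ℤ.*_) (+∣+m*i∣ n (+ n)))))
    where
    identity : ∀ a b → let m = + 1 ℤ.+ a; n = + 1 ℤ.+ b in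
      n ℤ.* (m ℤ.- + 2) ℤ.* (m ℤ.+ n)
        ℤ.- (m ℤ.* (a ℤ.* n) ℤ.+ n ℤ.* (b ℤ.* m))
        ≡ ℤ.- (+ 2 ℤ.* (n ℤ.* n))
    identity = solve-∀

  lB-deviation : deviation t (m ℕ.+ n) lB ≡ + 2 ℤ.* (+ m ℤ.* + m)
  lB-deviation = trans (cong (λ z → + ∣ z ∣) (trans (cong (λ s → lB ℤ.* + (m ℕ.+ n) ℤ.- s) trace-CNRS≡) (identity (+ m') (+ n'))))
    (trans (cong +_ (ℤP.∣-i∣≡∣i∣ (+ 2 ℤ.* (+ m ℤ.* + m)))) (trans (+∣+m*i∣ 2 (+ m ℤ.* + m)) (cong (+ 2 ℤ.*_) (+∣+m*i∣ m (+ m)))))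
    where
    identity : ∀ a b → let m = + 1 ℤ.+ a; n = + 1 ℤ.+ b in
      m ℤ.* (n ℤ.- + 2) ℤ.* (m ℤ.+ n)
        ℤ.- (m ℤ.* (a ℤ.* n) ℤ.+ n ℤ.* (b ℤ.* m))
        ≡ ℤ.- (+ 2 ℤ.* (m ℤ.* m))
    identity = solve-∀

  energy-CNSL-fromDeviations : ∀ {DA DB} → deviation t (m ℕ.+ n) xA ≡ DA → deviation t (m ℕ.+ n) xB ≡ DB →
    ∀ v e → (DA ℤ.+ + m' ℤ.* (+ 2 ℤ.* (+ n ℤ.* + n)) ℤ.+ (DB ℤ.+ + n' ℤ.* (+ 2 ℤ.* (+ m ℤ.* + m)))) ℤ.* + suc e
              ≡ v ℤ.* + (m ℕ.+ n) →
    LECN⁺-is G (v /ₙ suc e)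
  energy-CNSL-fromDeviations {DA} {DB} xA≡ xB≡ v e cross = energy-ofSpectrum (CNSL G) spectrumCNSL t spectrum-CNSL
    (trans (energy≡Σdeviation/ₙ spectrumCNSL t (m' ℕ.+ n))
           (/ₙ-≡ (Σdeviation spectrumCNSL t (m ℕ.+ n)) v (m' ℕ.+ n) e (trans (cong (ℤ._* + suc e) Σ≡) cross)))
    where
    Σ≡ : Σdeviation spectrumCNSL t (m ℕ.+ n) ≡ DA ℤ.+ + m' ℤ.* (+ 2 ℤ.* (+ n ℤ.* + n)) ℤ.+ (DB ℤ.+ + n' ℤ.* (+ 2 ℤ.* (+ m ℤ.* + m)))
    Σ≡ = trans (Σdeviation-++ (xA ∷ replicate m' lA) (xB ∷ replicate n' lB) t (m ℕ.+ n)) (cong₂ ℤ._+_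
      (cong₂ ℤ._+_ xA≡ (trans (Σdeviation-replicate m' lA t (m ℕ.+ n)) (cong (+ m' ℤ.*_) lA-deviation)))
      (cong₂ ℤ._+_ xB≡ (trans (Σdeviation-replicate n' lB t (m ℕ.+ n)) (cong (+ n' ℤ.*_) lB-deviation))))

energy-CNSL-K̄₁∨K̄ₙ : ∀ b → let n = suc (suc b) in
  LECN⁺-is (join (Kbar 1) (Kbar n)) ((+ 2 ℤ.* (+ n ℤ.- + 1) ℤ.* (+ n ℤ.+ + 2)) /ₙ (n ℕ.+ 1))
energy-CNSL-K̄₁∨K̄ₙ b = energy-CNSL-fromDeviations xA≡ xB≡ (+ 2 ℤ.* (+ n ℤ.- + 1) ℤ.* (+ n ℤ.+ + 2)) (suc (b ℕ.+ 1)) (identity (+ b))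
  where
  open CompleteBipartiteSpectra 0 (suc b)
  xA≡ : deviation t (m ℕ.+ n) xA ≡ + n ℤ.* + suc b
  xA≡ = trans (cong (λ z → + ∣ z ∣) (trans xA-deviation (cong (+ n ℤ.*_) (inner (+ b)))))
              (+∣+m*i∣-nonpos n (suc b) refl)
    where
    inner : ∀ b → let n = + 2 ℤ.+ b in
      + 1 ℤ.* + 1 ℤ.+ n ℤ.* (+ 1 ℤ.- + 2) ≡ ℤ.- (+ 1 ℤ.+ b)
    inner = solve-∀
  xB≡ : deviation t (m ℕ.+ n) xB ≡ + 1 ℤ.* ((+ 4 ℤ.+ + b) ℤ.* + suc b)
  xB≡ = trans (cong (λ z → + ∣ z ∣) (trans xB-deviation (cong (+ 1 ℤ.*_) (inner (+ b)))))
              (+∣+m*i∣-nonneg 1 ((4 ℕ.+ b) ℕ.* suc b) (sym (ℤP.pos-* (4 ℕ.+ b) (suc b))))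
    where
    inner : ∀ b → let n = + 2 ℤ.+ b in
      n ℤ.* n ℤ.+ + 1 ℤ.* (n ℤ.- + 2) ≡ (+ 4 ℤ.+ b) ℤ.* (+ 1 ℤ.+ b)
    inner = solve-∀
  identity : ∀ b → let n = + 2 ℤ.+ b in
    (n ℤ.* (+ 1 ℤ.+ b) ℤ.+ + 0 ℤ.* (+ 2 ℤ.* (n ℤ.* n))
      ℤ.+ (+ 1 ℤ.* ((+ 4 ℤ.+ b) ℤ.* (+ 1 ℤ.+ b)) ℤ.+ (+ 1 ℤ.+ b) ℤ.* (+ 2 ℤ.* (+ 1 ℤ.* + 1)))) ℤ.* (+ 2 ℤ.+ (b ℤ.+ + 1))
      ≡ + 2 ℤ.* (n ℤ.- + 1) ℤ.* (n ℤ.+ + 2) ℤ.* (+ 1 ℤ.+ n)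
  identity = solve-∀

energy-CNSL-K̄ₘ∨K̄₁ : ∀ a → let m = suc (suc a) in
  LECN⁺-is (join (Kbar m) (Kbar 1)) ((+ 2 ℤ.* (+ m ℤ.- + 1) ℤ.* (+ m ℤ.+ + 2)) /ₙ (m ℕ.+ 1))
energy-CNSL-K̄ₘ∨K̄₁ a = energy-CNSL-fromDeviations xA≡ xB≡ (+ 2 ℤ.* (+ m ℤ.- + 1) ℤ.* (+ m ℤ.+ + 2)) (suc (a ℕ.+ 1)) (identity (+ a))
  where
  open CompleteBipartiteSpectra (suc a) 0
  xA≡ : deviation t (m ℕ.+ n) xA ≡ + 1 ℤ.* ((+ 4 ℤ.+ + a) ℤ.* + suc a)
  xA≡ = trans (cong (λ z → + ∣ z ∣) (trans xA-deviation (cong (+ 1 ℤ.*_) (inner (+ a)))))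
              (+∣+m*i∣-nonneg 1 ((4 ℕ.+ a) ℕ.* suc a) (sym (ℤP.pos-* (4 ℕ.+ a) (suc a))))
    where
    inner : ∀ a → let m = + 2 ℤ.+ a in
      m ℤ.* m ℤ.+ + 1 ℤ.* (m ℤ.- + 2) ≡ (+ 4 ℤ.+ a) ℤ.* (+ 1 ℤ.+ a)
    inner = solve-∀
  xB≡ : deviation t (m ℕ.+ n) xB ≡ + m ℤ.* + suc a
  xB≡ = trans (cong (λ z → + ∣ z ∣) (trans xB-deviation (cong (+ m ℤ.*_) (inner (+ a)))))
              (+∣+m*i∣-nonpos m (suc a) refl)
    where
    inner : ∀ a → let m = + 2 ℤ.+ a in
      + 1 ℤ.* + 1 ℤ.+ m ℤ.* (+ 1 ℤ.- + 2) ≡ ℤ.- (+ 1 ℤ.+ a)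
    inner = solve-∀
  identity : ∀ a → let m = + 2 ℤ.+ a in
    (+ 1 ℤ.* ((+ 4 ℤ.+ a) ℤ.* (+ 1 ℤ.+ a)) ℤ.+ (+ 1 ℤ.+ a) ℤ.* (+ 2 ℤ.* (+ 1 ℤ.* + 1))
      ℤ.+ (m ℤ.* (+ 1 ℤ.+ a) ℤ.+ + 0 ℤ.* (+ 2 ℤ.* (m ℤ.* m)))) ℤ.* (+ 2 ℤ.+ (a ℤ.+ + 1))
      ≡ + 2 ℤ.* (m ℤ.- + 1) ℤ.* (m ℤ.+ + 2) ℤ.* (m ℤ.+ + 1)
  identity = solve-∀

energy-CNSL-K̄ₘ∨K̄ₙ : ∀ a b → let m = suc (suc a); n = suc (suc b) in
  LECN⁺-is (join (Kbar m) (Kbar n)) ((+ 4 ℤ.* (+ m ℤ.* + m ℤ.* (+ n ℤ.- + 1) ℤ.+ + n ℤ.* + n ℤ.* (+ m ℤ.- + 1))) /ₙ (m ℕ.+ n))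
energy-CNSL-K̄ₘ∨K̄ₙ a b = energy-CNSL-fromDeviations xA≡ xB≡
  (+ 4 ℤ.* (+ m ℤ.* + m ℤ.* (+ n ℤ.- + 1) ℤ.+ + n ℤ.* + n ℤ.* (+ m ℤ.- + 1)))
  (suc (a ℕ.+ n)) (identity (+ a) (+ b))
  where
  open CompleteBipartiteSpectra (suc a) (suc b)
  minus2 : ∀ a → (+ 2 ℤ.+ a) ℤ.- + 2 ≡ a
  minus2 = solve-∀
  xA≡ : deviation t (m ℕ.+ n) xA ≡ + n ℤ.* (+ m ℤ.* + m ℤ.+ + n ℤ.* + a)
  xA≡ = trans (cong (λ z → + ∣ z ∣) (trans xA-deviation (cong (λ z → + n ℤ.* (+ m ℤ.* + m ℤ.+ + n ℤ.* z)) (minus2 (+ a)))))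
              (+∣+m*i∣-nonneg n (m ℕ.* m ℕ.+ n ℕ.* a) (sym (cong₂ ℤ._+_ (ℤP.pos-* m m) (ℤP.pos-* n a))))
  xB≡ : deviation t (m ℕ.+ n) xB ≡ + m ℤ.* (+ n ℤ.* + n ℤ.+ + m ℤ.* + b)
  xB≡ = trans (cong (λ z → + ∣ z ∣) (trans xB-deviation (cong (λ z → + m ℤ.* (+ n ℤ.* + n ℤ.+ + m ℤ.* z)) (minus2 (+ b)))))
              (+∣+m*i∣-nonneg m (n ℕ.* n ℕ.+ m ℕ.* b) (sym (cong₂ ℤ._+_ (ℤP.pos-* n n) (ℤP.pos-* m b))))
  identity : ∀ a b → let m = + 2 ℤ.+ a; n = + 2 ℤ.+ b in
    (n ℤ.* (m ℤ.* m ℤ.+ n ℤ.* a) ℤ.+ (+ 1 ℤ.+ a) ℤ.* (+ 2 ℤ.* (n ℤ.* n))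
      ℤ.+ (m ℤ.* (n ℤ.* n ℤ.+ m ℤ.* b) ℤ.+ (+ 1 ℤ.+ b) ℤ.* (+ 2 ℤ.* (m ℤ.* m)))) ℤ.* (m ℤ.+ n)
      ≡ + 4 ℤ.* (m ℤ.* m ℤ.* (n ℤ.- + 1) ℤ.+ n ℤ.* n ℤ.* (m ℤ.- + 1)) ℤ.* (m ℤ.+ n)
  identity = solve-∀

completeBipartite-CN-spectra : ∀ m n → 1 ≤ m → 1 ≤ n →
    IsSpectrum (CNL (join (Kbar m) (Kbar n))) (+ 0 ∷ + 0 ∷ replicate (m ℕ.+ n ∸ 2) (+ (m ℕ.* n)))
  × LECN-is (join (Kbar m) (Kbar n)) ((+ 4 ℤ.* + m ℤ.* + n ℤ.* (+ m ℤ.+ + n ℤ.- + 2)) /ₙ (m ℕ.+ n))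
  × IsSpectrum (CNSL (join (Kbar m) (Kbar n)))
      (((+ 2 ℤ.* + n ℤ.* (+ m ℤ.- + 1)) ∷ replicate (m ∸ 1) (+ n ℤ.* (+ m ℤ.- + 2)))
       ++ ((+ 2 ℤ.* + m ℤ.* (+ n ℤ.- + 1)) ∷ replicate (n ∸ 1) (+ m ℤ.* (+ n ℤ.- + 2))))
  × (m ≡ 1 → 2 ≤ n → LECN⁺-is (join (Kbar m) (Kbar n)) ((+ 2 ℤ.* (+ n ℤ.- + 1) ℤ.* (+ n ℤ.+ + 2)) /ₙ (n ℕ.+ 1)))
  × (2 ≤ m → n ≡ 1 → LECN⁺-is (join (Kbar m) (Kbar n)) ((+ 2 ℤ.* (+ m ℤ.- + 1) ℤ.* (+ m ℤ.+ + 2)) /ₙ (m ℕ.+ 1)))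
  × (2 ≤ m → 2 ≤ n → LECN⁺-is (join (Kbar m) (Kbar n))
      ((+ 4 ℤ.* (+ m ℤ.* + m ℤ.* (+ n ℤ.- + 1) ℤ.+ + n ℤ.* + n ℤ.* (+ m ℤ.- + 1))) /ₙ (m ℕ.+ n)))
completeBipartite-CN-spectra (suc m') (suc n') _ _ =
    coeff-≡ spectrum-CNL , energy-CNL , coeff-≡ spectrum-CNSL
  , (λ { refl (s≤s (s≤s z≤n)) → energy-CNSL-K̄₁∨K̄ₙ _ })
  , (λ { (s≤s (s≤s z≤n)) refl → energy-CNSL-K̄ₘ∨K̄₁ _ })
  , (λ { (s≤s (s≤s z≤n)) (s≤s (s≤s z≤n)) → energy-CNSL-K̄ₘ∨K̄ₙ _ _ })
  where open CompleteBipartiteSpectra m' n'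

1≤sum : ∀ ns → ns ≢ [] → All (1 ≤_) ns → 1 ≤ sum ns
1≤sum []       ns≢[] _         = contradiction refl ns≢[]
1≤sum (n ∷ ns) _     (1≤n ∷ _) = ℕP.≤-trans 1≤n (ℕP.m≤m+n n (sum ns))

proposition3p3 :
    -- (1) complete multipartite-of-cliques join K_{n1} ∨ ... ∨ K_{nk}
    ((ns : List ℕ) → ns ≢ [] → All (1 ≤_) ns →
      IsSpectrum (CNL (joinK ns))
        (+ 0 ∷ replicate (sum ns ∸ 1) (+ sum ns ℤ.* (+ sum ns ℤ.- + 2)))
      × IsSpectrum (CNSL (joinK ns))
        ((+ 2 ℤ.* (+ sum ns ℤ.- + 1) ℤ.* (+ sum ns ℤ.- + 2))
          ∷ replicate (sum ns ∸ 1) ((+ sum ns ℤ.- + 2) ℤ.* (+ sum ns ℤ.- + 2)))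
      × LECN-is (joinK ns) ((+ 2 ℤ.* (+ sum ns ℤ.- + 1) ℤ.* (+ sum ns ℤ.- + 2)) /ₙ 1)
      × LECN⁺-is (joinK ns) ((+ 2 ℤ.* (+ sum ns ℤ.- + 1) ℤ.* (+ sum ns ℤ.- + 2)) /ₙ 1))
    ×
    -- (2) complete bipartite graph \overline{K_m} ∨ \overline{K_n}
    ((m n : ℕ) → 1 ≤ m → 1 ≤ n →
      IsSpectrum (CNL (join (Kbar m) (Kbar n)))
        (+ 0 ∷ + 0 ∷ replicate (m ℕ.+ n ∸ 2) (+ (m ℕ.* n)))
      × LECN-is (join (Kbar m) (Kbar n))
          ((+ 4 ℤ.* + m ℤ.* + n ℤ.* (+ m ℤ.+ + n ℤ.- + 2)) /ₙ (m ℕ.+ n))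
      × IsSpectrum (CNSL (join (Kbar m) (Kbar n)))
          (((+ 2 ℤ.* + n ℤ.* (+ m ℤ.- + 1))
             ∷ replicate (m ∸ 1) (+ n ℤ.* (+ m ℤ.- + 2)))
           ++ ((+ 2 ℤ.* + m ℤ.* (+ n ℤ.- + 1))
             ∷ replicate (n ∸ 1) (+ m ℤ.* (+ n ℤ.- + 2))))
      × (m ≡ 1 → 2 ≤ n → LECN⁺-is (join (Kbar m) (Kbar n))
          ((+ 2 ℤ.* (+ n ℤ.- + 1) ℤ.* (+ n ℤ.+ + 2)) /ₙ (n ℕ.+ 1)))
      × (2 ≤ m → n ≡ 1 → LECN⁺-is (join (Kbar m) (Kbar n))
          ((+ 2 ℤ.* (+ m ℤ.- + 1) ℤ.* (+ m ℤ.+ + 2)) /ₙ (m ℕ.+ 1)))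
      × (2 ≤ m → 2 ≤ n → LECN⁺-is (join (Kbar m) (Kbar n))
          ((+ 4 ℤ.* (+ m ℤ.* + m ℤ.* (+ n ℤ.- + 1) ℤ.+ + n ℤ.* + n ℤ.* (+ m ℤ.- + 1)))
            /ₙ (m ℕ.+ n))))
proposition3p3 =
    (λ ns ns≢[] ns≥1 → complete-CN-spectra (sum ns) (joinK ns) (joinK-complete ns) (1≤sum ns ns≢[] ns≥1))
  , completeBipartite-CN-spectra
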